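{- Let $G$ be a tree with root $r$ and $p(r)=0$, consider an execution of the density-greedy algorithm for trees on $G$ with output $\pi$, and let $T_1,\dots,T_k$ be defined as in the context. Let $B\in\mathbb{R}_{\ge0}$ and $1\le j\le k$ satisfy $\sum_{i=1}^{j-1}c(T_i)\le B\le\sum_{i=1}^{j}c(T_i)$. Then $$p(\textsc{Alg}(B+\chi))\ \ge\ \sum_{i=1}^{j-1}d(T_i)c(T_i)+d(T_j)\Bigl(B-\sum_{i=1}^{j-1}c(T_i)\Bigr).$$
   Context: $G=(V,E)$ is a tree with edge costs $c(e)>0$, prizes $p(v)\ge0$, root $r$; $p(S)$, $c(S)$ denote total prize and cost of a subgraph $S$. Rooted subtree: subtree containing $r$; for rooted $T$ with an edge $d(T)=p(T)/c(T)$ (trivial tree: 0). A min-max subtree is an inclusion-wise minimal rooted subtree of maximum density. For a rooted subtree $\overline T$, $G/\overline T$ is obtained by contracting $\overline T$ into $r$ (root prize $0$, other prizes and costs unchanged); the extension of a subgraph of $G/\overline T$ is the subgraph of $G$ formed by the corresponding edges. For any subtree $S$ of $G$ with an edge, $r_S$ is its vertex closest to $r$, and we write $d(S)=d_G(S)=(p(S)-p(r_S))/c(S)$ (consistent with the rooted case since $p(r)=0$). $\chi=\max_v\ell(v)$, $\ell(v)$ the cost of the $r$-$v$ path. $\textsc{Alg}(B)$ is the rooted subtree formed by $r$ and the edges $e_i$ of $\pi=(e_1,\dots,e_l)$ with $\sum_{j\le i}c(e_j)\le B$. Density-greedy algorithm for trees: $\pi=()$, $\overline T=(\{r\},\emptyset)$;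 while $G/\overline T$ has nonzero total prize: choose an arbitrary min-max subtree of $G/\overline T$, append to $\pi$ the edge of $G$ corresponding to its unique edge incident to $r$, add that edge to $\overline T$. Trees $T_1,\dots,T_k$: set $t_1=1$; $T_i$ is the extension in $G$ of the min-max subtree chosen in iteration $t_i$, and $t_{i+1}=t_i+|E(T_i)|$; this is continued as long as $t_i$ does not exceed the number of iterations, and $k$ is the number of trees so obtained.
   Formalization: The edge costs $c(e)$, the prizes $p(v)$ and the number $B$ are rational rather than real. -}

module Defs where

open import Data.Nat as ℕ using (ℕ; zero; suc)
open import Data.Fin using (Fin; zero; suc; toℕ; fromℕ<)
open import Data.Fin.Subset using (Subset; _∈_; _∉_; _⊆_; ⁅_⁆; _∪_; ∁; ∣_∣)
open import Data.Bool using (if_then_else_)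
open import Data.List using (List; []; _∷_; foldr; map; allFin; take; length; lookup)
open import Data.Vec as Vec using ()
open import Data.Product using (Σ; _×_)
open import Data.Sum using (_⊎_)
open import Relation.Nullary using (yes; no; ¬_)
open import Relation.Binary.PropositionalEquality using (_≡_; _≢_)
open import Data.Rational using (ℚ; 0ℚ; _+_; _*_; _÷_; _≤_; _<_; _⊔_; ≢-nonZero)
open import Data.Rational.Properties using (_≟_; _≤?_)

-- Vertices: Fin (suc n), root r = zero.  Edges: Fin n, edge i joins
-- vertex (suc i) (its child endpoint) to its parent  par i.
-- Labelling convention (w.l.o.g., e.g. BFS order): the parent of
-- vertex (suc i) has index ≤ i, which makes the graph a tree rooted at 0.

record Tree (n : ℕ) : Set where
  field
    par  : Fin n → Fin (suc n)
    par≤ : ∀ i → toℕ (par i) ℕ.≤ toℕ i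
    c    : Fin n → ℚ
    c>0  : ∀ i → 0ℚ < c i
    p    : Fin (suc n) → ℚ
    p≥0  : ∀ v → 0ℚ ≤ p v

-- total division (x / 0 := 0); used only with positive denominators
-- except for trivial (edgeless) trees, whose density is 0 by convention.
_÷'_ : ℚ → ℚ → ℚ
x ÷' y with y ≟ 0ℚ
... | yes _  = 0ℚ
... | no y≢0 = _÷_ x y {{≢-nonZero y≢0}}

Σ∈ : ∀ {m} → Subset m → (Fin m → ℚ) → ℚ
Σ∈ {m} S f = foldr _+_ 0ℚ (map (λ i → if Vec.lookup S i then f i else 0ℚ) (allFin m))

sumℚ : List ℚ → ℚ
sumℚ = foldr _+_ 0ℚ

module _ {n : ℕ} (G : Tree n) where
  open Tree G

  -- cost ℓ(v) of the r-v path (fuel n suffices since parents have smaller index)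
  pathCost : ℕ → Fin (suc n) → ℚ
  pathCost zero    _       = 0ℚ
  pathCost (suc f) zero    = 0ℚ
  pathCost (suc f) (suc i) = c i + pathCost f (par i)

  ℓ : Fin (suc n) → ℚ
  ℓ = pathCost n

  χ : ℚ
  χ = foldr _⊔_ 0ℚ (map ℓ (allFin (suc n)))

  -- prize and cost of a set of edges (edges identified with child endpoints)
  -- For a subtree S of G with edge set E: V(S) ∖ {r_S} = child endpoints of E,
  -- so p(S) - p(r_S) = prizeE E  and  c(S) = costE E.
  prizeE : Subset n → ℚ
  prizeE E = Σ∈ E (λ i → p (suc i))

  costE : Subset n → ℚ
  costE E = Σ∈ E c

  -- density d_G(S) = (p(S) - p(r_S)) / c(S) of a subtree given by its edge set;
  -- 0 for the trivial tree.
  dens : Subset n → ℚ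
  dens E = prizeE E ÷' costE E

  -- Contraction G/T̄ of a rooted subtree T̄ (given by its vertex set).
  -- A subgraph of G/T̄ is identified with its extension (its edge set in G).
  -- Y is (the edge set of) a rooted subtree of G/T̄: edges outside T̄ and
  -- every edge's upper endpoint is either in T̄ (= the contracted root) or
  -- the child endpoint of another edge of Y.
  IsRootedC : Subset (suc n) → Subset n → Set
  IsRootedC Tb Y =
    (∀ i → i ∈ Y → suc i ∉ Tb) ×
    (∀ i → i ∈ Y → par i ∈ Tb ⊎ Σ (Fin n) (λ j → par i ≡ suc j × j ∈ Y))

  -- in G/T̄ the root has prize 0, other prizes/costs unchanged:
  -- p_{G/T̄}(Y) = prizeE Y, c_{G/T̄}(Y) = costE Y, so d_{G/T̄}(Y) = dens Y.
  densC : Subset (suc n) → Subset n → ℚ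
  densC Tb Y = dens Y

  IsMinMax : Subset (suc n) → Subset n → Set
  IsMinMax Tb Y =
    IsRootedC Tb Y ×
    (∀ Y' → IsRootedC Tb Y' → densC Tb Y' ≤ densC Tb Y) ×
    (∀ Y' → IsRootedC Tb Y' → Y' ⊆ Y → densC Tb Y' ≡ densC Tb Y → Y' ≡ Y)

  -- total prize of G/T̄ (root prize 0)
  totalPrizeC : Subset (suc n) → ℚ
  totalPrizeC Tb = Σ∈ (∁ Tb) p

  rootedBy : List (Fin n) → Subset (suc n)
  rootedBy = foldr (λ e S → ⁅ suc e ⁆ ∪ ⁅ par e ⁆ ∪ S) ⁅ zero ⁆

  record Execution : Set where
    field
      π    : List (Fin n)
      Y    : Fin (length π) → Subset n
      step : ∀ t →
        let Tb = rootedBy (take (toℕ t) π) in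
        (totalPrizeC Tb ≢ 0ℚ) ×
        IsMinMax Tb (Y t) ×
        (lookup π t ∈ Y t) ×
        (par (lookup π t) ∈ Tb)
      stop : totalPrizeC (rootedBy π) ≡ 0ℚ

  module _ (X : Execution) where
    open Execution X

    -- iterations t_1, t_2, ... (0-based): t_{i+1} = t_i + |E(T_i)|,
    -- while t_i < number of iterations (fuel = number of iterations).
    starts : ℕ → ℕ → List (Fin (length π))
    starts zero    s = []
    starts (suc f) s with s ℕ.<? length π
    ... | yes s< = fromℕ< s< ∷ starts f (s ℕ.+ ∣ Y (fromℕ< s<) ∣)
    ... | no  _  = []

    Ts : List (Subset n)
    Ts = map Y (starts (length π) 0)

    k : ℕ
    k = length Ts

    algEdges : ℚ → ℚ → List (Fin n) → List (Fin n)
    algEdges B acc []       = []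
    algEdges B acc (e ∷ es) with (acc + c e) ≤? B
    ... | yes _ = e ∷ algEdges B (acc + c e) es
    ... | no  _ = algEdges B (acc + c e) es

    pAlg : ℚ → ℚ
    pAlg B = Σ∈ (rootedBy (algEdges B 0ℚ π)) p

-- Measure an edge set E at density D by its excess p(E) − D·c(E). A min-max subtree Y of G/T̄
-- has excess 0 at its own density d(Y), every rooted subtree of G/T̄ has excess ≤ 0 there, and
-- every nonempty proper rooted subtree of Y has negative excess. Exchange arguments with these
-- three facts show that once Y is chosen at iteration a, the next |Y| iterations pick exactly the
-- edges of Y, each of them choosing a subtree of Y of larger density, and that Y hangs below its
-- top edge. Inside such a block, induction over the nested sub-blocks shows that the edges picked
-- in iterations a, …, t − 1 have excess at least −d(Y) times the length of the path from the top
-- of Y down to the edge picked at iteration t. Alg(B + χ) contains every prefix of π of cost at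
-- most B + χ; for the longest one ending inside the block of T_j, this bound and ℓ ≤ χ give the
-- claimed prize.

module Submission where

open import Defs
open import Data.Nat using (ℕ; suc)
open import Data.Fin using (Fin; zero; toℕ)
open import Data.List using (map; take; lookup)
open import Relation.Binary.PropositionalEquality using (_≡_)
open import Data.Rational using (ℚ; 0ℚ; _+_; _-_; _*_; _≤_)

import Data.Nat as ℕ
import Data.Nat.Properties as ℕ
open import Data.Nat.Induction using (<-rec)
open import Data.Bool using (Bool; if_then_else_)
open import Data.Fin as Fin using (suc; fromℕ<)
open import Data.Fin.Properties using (toℕ<n; toℕ≤pred[n]; suc-injective; toℕ-fromℕ<)
open import Data.Fin.Subset as Subset
  using (Subset; ⋃; ∁; _∈_; _∉_; _⊆_; _⊂_; ⁅_⁆; _∪_; _∩_; _─_; ∣_∣; Nonempty; inside; outside)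
open import Data.Fin.Subset.Properties
  using ( _∈?_; nonempty?; drop-there; drop-∷-⊆; ⊆-antisym; ⊥⊆; ∉⊥; x∈⁅x⁆; x∈⁅y⁆⇒x≡y; x∉p⇒x∈∁p
        ; x∈p∪q⁺; x∈p∪q⁻; x∈p∩q⁺; x∈p∩q⁻; x∈p∧x∉q⇒x∈p─q; p⊆p∪q; p∩q⊆p; p∩q⊆q; p─q⊆p
        ; ∪-identityʳ; ∪-identityˡ; ∪-assoc; p⊆q⇒∣p∣≤∣q∣; p⊂q⇒∣p∣<∣q∣; ∣⊥∣≡0; ∣⁅x⁆∣≡1)
open import Data.List using (List; []; _∷_; _∷ʳ_; length; foldr; tabulate)
open import Data.List.Properties using (map-tabulate; map-++; take-map; take-all; map-cong)
open import Data.List.Relation.Unary.All as All using (All; []; _∷_)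
open import Data.List.Relation.Unary.All.Properties using (∷ʳ⁺)
open import Data.Product using (Σ; _×_; _,_; proj₁; proj₂)
open import Data.Rational using (_<_; -_; _⊔_; 1ℚ; 1/_; nonNegative; positive; ≢-nonZero)
open import Data.Rational.Properties
open import Data.Rational.Solver using (module +-*-Solver)
open import Data.Sum using (_⊎_; inj₁; inj₂; [_,_]′)
open import Data.Vec as Vec using (_∷_; []; here; there)
open import Function using (_∘_; id)
open import Relation.Binary.Definitions using (tri<; tri≈; tri>)
open import Relation.Binary.PropositionalEquality
  using (_≢_; refl; sym; trans; cong; cong₂; subst; subst₂; module ≡-Reasoning)
open import Relation.Nullary using (¬_; contradiction)
open import Relation.Nullary.Decidable as Dec using (Dec; does; yes; no; _⊎-dec_)
open import Relation.Unary using (Decidable)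

open +-*-Solver

<⇒≱ : ∀ {x y} → x < y → ¬ (y ≤ x)
<⇒≱ x<y y≤x = <-irrefl refl (<-≤-trans x<y y≤x)

0≤-+ : ∀ {x y} → 0ℚ ≤ x → 0ℚ ≤ y → 0ℚ ≤ x + y
0≤-+ = +-mono-≤

0≤-* : ∀ {x y} → 0ℚ ≤ x → 0ℚ ≤ y → 0ℚ ≤ x * y
0≤-* {x} {y} 0≤x 0≤y = subst (_≤ x * y) (*-zeroʳ x) (*-monoˡ-≤-nonNeg x {{nonNegative 0≤x}} 0≤y)

0<-* : ∀ {x y} → 0ℚ < x → 0ℚ < y → 0ℚ < x * y
0<-* {x} {y} 0<x 0<y = subst (_< x * y) (*-zeroʳ x) (*-monoʳ-<-pos x {{positive 0<x}} 0<y)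

≤⇒0≤- : ∀ {x y} → x ≤ y → 0ℚ ≤ y - x
≤⇒0≤- {x} {y} x≤y = subst (_≤ y - x) (+-inverseʳ x) (+-monoˡ-≤ (- x) x≤y)

<⇒0<- : ∀ {x y} → x < y → 0ℚ < y - x
<⇒0<- {x} {y} x<y = subst (_< y - x) (+-inverseʳ x) (+-monoˡ-< (- x) x<y)

≤-by-nonNeg-gap : ∀ {x} y {z} → 0ℚ ≤ z → y ≡ x + z → x ≤ y
≤-by-nonNeg-gap {x} y 0≤z y≡x+z = subst₂ _≤_ (+-identityʳ x) (sym y≡x+z) (+-monoʳ-≤ x 0≤z)

0≤-⇒≤ : ∀ {x y} → 0ℚ ≤ y - x → x ≤ y
0≤-⇒≤ {x} {y} 0≤y-x = ≤-by-nonNeg-gap y 0≤y-x (solve 2 (λ x y → y := x :+ (y :- x)) refl x y)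

<-by-pos-gap : ∀ {x} y {z} → 0ℚ < z → y ≡ x + z → x < y
<-by-pos-gap {x} y 0<z y≡x+z = subst₂ _<_ (+-identityʳ x) (sym y≡x+z) (+-monoʳ-< x 0<z)

+≡0∧<0⇒0< : ∀ {x y} → x + y ≡ 0ℚ → x < 0ℚ → 0ℚ < y
+≡0∧<0⇒0< {x} {y} x+y≡0 x<0 = subst₂ _<_ x+y≡0 (+-identityˡ y) (+-monoˡ-< y x<0)

+≡0∧≤0⇒0≤ : ∀ {x y} → x + y ≡ 0ℚ → x ≤ 0ℚ → 0ℚ ≤ y
+≡0∧≤0⇒0≤ {x} {y} x+y≡0 x≤0 = subst₂ _≤_ x+y≡0 (+-identityˡ y) (+-monoˡ-≤ y x≤0)

+-cancelˡ-≡ : ∀ x {y z} → x + y ≡ x + z → y ≡ z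
+-cancelˡ-≡ x {y} {z} x+y≡x+z = begin
  y              ≡⟨ cancel x y ⟩
  - x + (x + y)  ≡⟨ cong (- x +_) x+y≡x+z ⟩
  - x + (x + z)  ≡⟨ sym (cancel x z) ⟩
  z              ∎
  where
  open ≡-Reasoning
  cancel : ∀ x y → y ≡ - x + (x + y)
  cancel = solve 2 (λ x y → y := :- x :+ (x :+ y)) refl

combine-bounds : ∀ x y {D c ℓa ℓb ℓt} →
                 0ℚ ≤ x + D * c → 0ℚ ≤ y + D * (ℓt - ℓb) → 0ℚ ≤ D → ℓa + c ≤ ℓb →
                 0ℚ ≤ (x + y) + D * (ℓt - ℓa)
combine-bounds x y {D} {c} {ℓa} {ℓb} {ℓt} 0≤x+Dc 0≤y+DΔ 0≤D ℓa+c≤ℓb =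
  ≤-trans (0≤-+ 0≤x+Dc 0≤y+DΔ) (≤-by-nonNeg-gap ((x + y) + D * (ℓt - ℓa)) (0≤-* 0≤D (≤⇒0≤- ℓa+c≤ℓb))
    (solve 7 (λ x y D c ℓa ℓb ℓt → (x :+ y) :+ D :* (ℓt :- ℓa)
                                  := ((x :+ D :* c) :+ (y :+ D :* (ℓt :- ℓb))) :+ D :* (ℓb :- (ℓa :+ c)))
             refl x y D c ℓa ℓb ℓt))

÷'-*-cancel : ∀ x y → (y ≡ 0ℚ → x ≡ 0ℚ) → x ≡ (x ÷' y) * y
÷'-*-cancel x y y≡0⇒x≡0 with y ≟ 0ℚ
... | yes y≡0 = trans (y≡0⇒x≡0 y≡0) (sym (*-zeroˡ y))
... | no  y≢0 = sym (begin
  x * (1/ y) * y   ≡⟨ *-assoc x _ y ⟩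
  x * (1/ y * y)   ≡⟨ cong (x *_) (*-inverseˡ y) ⟩
  x * 1ℚ           ≡⟨ *-identityʳ x ⟩
  x                ∎)
  where
  open ≡-Reasoning
  instance _ = ≢-nonZero y≢0

÷'-nonNeg : ∀ {x y} → 0ℚ ≤ x → 0ℚ ≤ y → 0ℚ ≤ x ÷' y
÷'-nonNeg {x} {y} 0≤x 0≤y with y ≟ 0ℚ
... | yes _   = ≤-refl
... | no  y≢0 = 0≤-* 0≤x (<⇒≤ (positive⁻¹ _ {{1/pos⇒pos y}}))
  where
  instance
    _ = ≢-nonZero y≢0
    _ = nonNeg∧nonZero⇒pos y {{nonNegative 0≤y}}

≤-foldr-⊔-tabulate : ∀ {m} (f : Fin m → ℚ) i → f i ≤ foldr _⊔_ 0ℚ (tabulate f)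
≤-foldr-⊔-tabulate f zero    = p≤p⊔q (f zero) _
≤-foldr-⊔-tabulate f (suc i) = p≤q⇒p≤r⊔q (f zero) (≤-foldr-⊔-tabulate (f ∘ suc) i)

Disjoint : ∀ {m} → Subset m → Subset m → Set
Disjoint p q = ∀ {x} → x ∈ p → x ∉ q

x∈p─q⇒x∉q : ∀ {m} {x : Fin m} {p q : Subset m} → x ∈ p ─ q → x ∉ q
x∈p─q⇒x∉q {p = _ ∷ p} {inside ∷ q}  (there x∈p─q) (there x∈q) = x∈p─q⇒x∉q x∈p─q x∈q
x∈p─q⇒x∉q {p = _ ∷ p} {outside ∷ q} (there x∈p─q) (there x∈q) = x∈p─q⇒x∉q x∈p─q x∈q

x∈p⇒⁅x⁆⊆p : ∀ {m} {x : Fin m} {p} → x ∈ p → ⁅ x ⁆ ⊆ p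
x∈p⇒⁅x⁆⊆p {p = p} x∈p y∈⁅x⁆ = subst (_∈ p) (sym (x∈⁅y⁆⇒x≡y _ y∈⁅x⁆)) x∈p

x∈p⇒0<∣p∣ : ∀ {m} {x : Fin m} {p} → x ∈ p → 0 ℕ.< ∣ p ∣
x∈p⇒0<∣p∣ {x = x} x∈p = subst (ℕ._≤ _) (∣⁅x⁆∣≡1 x) (p⊆q⇒∣p∣≤∣q∣ (x∈p⇒⁅x⁆⊆p x∈p))

∣p∪⁅x⁆∣≡1+∣p∣ : ∀ {m} {x : Fin m} {p : Subset m} → x ∉ p → ∣ p ∪ ⁅ x ⁆ ∣ ≡ suc ∣ p ∣
∣p∪⁅x⁆∣≡1+∣p∣ {x = zero}  {outside ∷ p} _   = cong (suc ∘ ∣_∣) (∪-identityʳ p)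
∣p∪⁅x⁆∣≡1+∣p∣ {x = zero}  {inside ∷ p}  x∉p = contradiction here x∉p
∣p∪⁅x⁆∣≡1+∣p∣ {x = suc x} {outside ∷ p} x∉p = ∣p∪⁅x⁆∣≡1+∣p∣ (x∉p ∘ there)
∣p∪⁅x⁆∣≡1+∣p∣ {x = suc x} {inside ∷ p}  x∉p = cong suc (∣p∪⁅x⁆∣≡1+∣p∣ (x∉p ∘ there))

⊆-∪-─ : ∀ {m} {A B : Subset m} → B ⊆ A ∪ (B ─ A)
⊆-∪-─ {A = A} {x = x} x∈B with x ∈? A
... | yes x∈A = x∈p∪q⁺ (inj₁ x∈A)
... | no  x∉A = x∈p∪q⁺ (inj₂ (x∈p∧x∉q⇒x∈p─q x∈B x∉A))

⊆⇒∩≡ : ∀ {m} {p q : Subset m} → q ⊆ p → p ∩ q ≡ q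
⊆⇒∩≡ {p = p} {q} q⊆p = ⊆-antisym (p∩q⊆q p q) (λ x∈q → x∈p∩q⁺ (q⊆p x∈q , x∈q))

∪≡∪-─ : ∀ {m} (p q : Subset m) → p ∪ q ≡ p ∪ (q ─ p)
∪≡∪-─ p q = ⊆-antisym ⊆ʳ ⊆ˡ
  where
  ⊆ʳ : p ∪ q ⊆ p ∪ (q ─ p)
  ⊆ʳ x∈ with x∈p∪q⁻ p q x∈
  ... | inj₁ x∈p = x∈p∪q⁺ (inj₁ x∈p)
  ... | inj₂ x∈q = ⊆-∪-─ x∈q
  ⊆ˡ : p ∪ (q ─ p) ⊆ p ∪ q
  ⊆ˡ x∈ with x∈p∪q⁻ p (q ─ p) x∈
  ... | inj₁ x∈p   = x∈p∪q⁺ (inj₁ x∈p)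
  ... | inj₂ x∈q─p = x∈p∪q⁺ (inj₂ (p─q⊆p q p x∈q─p))

─-∪⁅⁆ : ∀ {m} {x : Fin m} (p q : Subset m) → x ∉ q → (p ∪ ⁅ x ⁆) ─ q ≡ (p ─ q) ∪ ⁅ x ⁆
─-∪⁅⁆ {x = x} p q x∉q = ⊆-antisym ⊆ʳ ⊆ˡ
  where
  ⊆ʳ : (p ∪ ⁅ x ⁆) ─ q ⊆ (p ─ q) ∪ ⁅ x ⁆
  ⊆ʳ y∈ with x∈p∪q⁻ p ⁅ x ⁆ (p─q⊆p _ q y∈)
  ... | inj₁ y∈p = x∈p∪q⁺ (inj₁ (x∈p∧x∉q⇒x∈p─q y∈p (x∈p─q⇒x∉q y∈)))
  ... | inj₂ y∈x = x∈p∪q⁺ (inj₂ y∈x)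
  ⊆ˡ : (p ─ q) ∪ ⁅ x ⁆ ⊆ (p ∪ ⁅ x ⁆) ─ q
  ⊆ˡ y∈ with x∈p∪q⁻ (p ─ q) ⁅ x ⁆ y∈
  ... | inj₁ y∈p─q = x∈p∧x∉q⇒x∈p─q (x∈p∪q⁺ (inj₁ (p─q⊆p p q y∈p─q))) (x∈p─q⇒x∉q y∈p─q)
  ... | inj₂ y∈x   = subst (_∈ (p ∪ ⁅ x ⁆) ─ q) (sym (x∈⁅y⁆⇒x≡y _ y∈x))
                              (x∈p∧x∉q⇒x∈p─q (x∈p∪q⁺ (inj₂ (x∈⁅x⁆ x))) x∉q)

subsetOf : ∀ {m} {P : Fin m → Set} → Decidable P → Subset m
subsetOf {ℕ.zero} P? = []
subsetOf {suc m}  P? = does (P? zero) ∷ subsetOf (P? ∘ suc)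

∈-subsetOf⁺ : ∀ {m} {P : Fin m → Set} (P? : Decidable P) {x} → P x → x ∈ subsetOf P?
∈-subsetOf⁺ P? {zero} Px with P? zero
... | yes _   = here
... | no ¬Px = contradiction Px ¬Px
∈-subsetOf⁺ P? {suc x} Px = there (∈-subsetOf⁺ (P? ∘ suc) Px)

∈-subsetOf⁻ : ∀ {m} {P : Fin m → Set} (P? : Decidable P) {x} → x ∈ subsetOf P? → P x
∈-subsetOf⁻ P? {zero} x∈ with P? zero | x∈
... | yes Px | _ = Px
... | no _   | ()
∈-subsetOf⁻ P? {suc x} (there x∈) = ∈-subsetOf⁻ (P? ∘ suc) x∈


Σ∈-∷ : ∀ {m} b (S : Subset m) (f : Fin (suc m) → ℚ) →
       Σ∈ (b ∷ S) f ≡ (if b then f zero else 0ℚ) + Σ∈ S (f ∘ suc)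
Σ∈-∷ {m} b S f = cong (λ xs → (if b then f zero else 0ℚ) + sumℚ xs)
  (trans (map-tabulate suc g) (sym (map-tabulate id (g ∘ suc))))
  where
  g : Fin (suc m) → ℚ
  g i = if Vec.lookup (b ∷ S) i then f i else 0ℚ

Σ∈-⊥ : ∀ {m} (f : Fin m → ℚ) → Σ∈ Subset.⊥ f ≡ 0ℚ
Σ∈-⊥ {ℕ.zero}  f = refl
Σ∈-⊥ {suc m} f = trans (Σ∈-∷ outside Subset.⊥ f) (trans (+-identityˡ _) (Σ∈-⊥ (f ∘ suc)))

Σ∈-⁅⁆ : ∀ {m} (x : Fin m) (f : Fin m → ℚ) → Σ∈ ⁅ x ⁆ f ≡ f x
Σ∈-⁅⁆ zero    f = trans (Σ∈-∷ inside Subset.⊥ f) (trans (cong (f zero +_) (Σ∈-⊥ (f ∘ suc))) (+-identityʳ _))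
Σ∈-⁅⁆ (suc x) f = trans (Σ∈-∷ outside ⁅ x ⁆ f) (trans (+-identityˡ _) (Σ∈-⁅⁆ x (f ∘ suc)))

Σ∈-∷-+ : ∀ {m} b c d {p q r : Subset m} (f : Fin (suc m) → ℚ) →
         (if b then f zero else 0ℚ) ≡ (if c then f zero else 0ℚ) + (if d then f zero else 0ℚ) →
         Σ∈ p (f ∘ suc) ≡ Σ∈ q (f ∘ suc) + Σ∈ r (f ∘ suc) →
         Σ∈ (b ∷ p) f ≡ Σ∈ (c ∷ q) f + Σ∈ (d ∷ r) f
Σ∈-∷-+ b c d {p} {q} {r} f head tail = begin
  Σ∈ (b ∷ p) f                  ≡⟨ Σ∈-∷ b p f ⟩
  [ b ] + Σ∈ p (f ∘ suc)         ≡⟨ cong₂ _+_ head tail ⟩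
  ([ c ] + [ d ]) + (Σ∈ q (f ∘ suc) + Σ∈ r (f ∘ suc))
    ≡⟨ solve 4 (λ u v x y → (u :+ v) :+ (x :+ y) := (u :+ x) :+ (v :+ y)) refl [ c ] [ d ] _ _ ⟩
  ([ c ] + Σ∈ q (f ∘ suc)) + ([ d ] + Σ∈ r (f ∘ suc))
    ≡⟨ sym (cong₂ _+_ (Σ∈-∷ c q f) (Σ∈-∷ d r f)) ⟩
  Σ∈ (c ∷ q) f + Σ∈ (d ∷ r) f    ∎
  where
  open ≡-Reasoning
  [_] : Bool → ℚ
  [ b ] = if b then f zero else 0ℚ

Σ∈-∪ : ∀ {m} {p q : Subset m} (f : Fin m → ℚ) → Disjoint p q → Σ∈ (p ∪ q) f ≡ Σ∈ p f + Σ∈ q f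
Σ∈-∪ {p = []}          {[]}          f _   = refl
Σ∈-∪ {p = inside ∷ p}  {inside ∷ q}  f p#q = contradiction here (p#q here)
Σ∈-∪ {p = inside ∷ p}  {outside ∷ q} f p#q =
  Σ∈-∷-+ inside inside outside f (sym (+-identityʳ _)) (Σ∈-∪ (f ∘ suc) (λ x∈p x∈q → p#q (there x∈p) (there x∈q)))
Σ∈-∪ {p = outside ∷ p} {c ∷ q}       f p#q =
  Σ∈-∷-+ c outside c f (sym (+-identityˡ _)) (Σ∈-∪ (f ∘ suc) (λ x∈p x∈q → p#q (there x∈p) (there x∈q)))

Σ∈-∪⁅⁆ : ∀ {m} {E : Subset m} {x} (f : Fin m → ℚ) → x ∉ E → Σ∈ (E ∪ ⁅ x ⁆) f ≡ Σ∈ E f + f x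
Σ∈-∪⁅⁆ {E = E} {x} f x∉E = trans (Σ∈-∪ f E#x) (cong (Σ∈ E f +_) (Σ∈-⁅⁆ x f))
  where
  E#x : Disjoint E ⁅ x ⁆
  E#x y∈E y∈x = x∉E (subst (_∈ E) (x∈⁅y⁆⇒x≡y _ y∈x) y∈E)

Σ∈-split : ∀ {m} (p q : Subset m) (f : Fin m → ℚ) → Σ∈ p f ≡ Σ∈ (p ∩ q) f + Σ∈ (p ─ q) f
Σ∈-split []            []            f = refl
Σ∈-split (inside ∷ p)  (inside ∷ q)  f = Σ∈-∷-+ inside inside outside f (sym (+-identityʳ _)) (Σ∈-split p q (f ∘ suc))
Σ∈-split (inside ∷ p)  (outside ∷ q) f = Σ∈-∷-+ inside outside inside f (sym (+-identityˡ _)) (Σ∈-split p q (f ∘ suc))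
Σ∈-split (outside ∷ p) (inside ∷ q)  f = Σ∈-∷-+ outside outside outside f refl (Σ∈-split p q (f ∘ suc))
Σ∈-split (outside ∷ p) (outside ∷ q) f = Σ∈-∷-+ outside outside outside f refl (Σ∈-split p q (f ∘ suc))

Σ∈-mono-⊆ : ∀ {m} {p q : Subset m} {f : Fin m → ℚ} → (∀ i → 0ℚ ≤ f i) → p ⊆ q → Σ∈ p f ≤ Σ∈ q f
Σ∈-mono-⊆ {p = []}    {[]}    _   _   = ≤-refl
Σ∈-mono-⊆ {p = b ∷ p} {c ∷ q} {f} 0≤f p⊆q = subst₂ _≤_ (sym (Σ∈-∷ b p f)) (sym (Σ∈-∷ c q f))
  (+-mono-≤ (head p⊆q) (Σ∈-mono-⊆ (0≤f ∘ suc) (drop-∷-⊆ p⊆q)))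
  where
  head : ∀ {b c} → (b ∷ p) ⊆ (c ∷ q) → (if b then f zero else 0ℚ) ≤ (if c then f zero else 0ℚ)
  head {inside}  {inside}  _   = ≤-refl
  head {inside}  {outside} b⊆c with b⊆c here
  ... | ()
  head {outside} {inside}  _   = 0≤f zero
  head {outside} {outside} _   = ≤-refl

Σ∈-nonNeg : ∀ {m} (p : Subset m) {f : Fin m → ℚ} → (∀ i → 0ℚ ≤ f i) → 0ℚ ≤ Σ∈ p f
Σ∈-nonNeg p {f} 0≤f = subst (_≤ Σ∈ p f) (Σ∈-⊥ f) (Σ∈-mono-⊆ {p = Subset.⊥} {q = p} 0≤f ⊥⊆)

Σ∈-pos : ∀ {m} {p : Subset m} {f : Fin m → ℚ} {x} → (∀ i → 0ℚ ≤ f i) → x ∈ p → 0ℚ < f x → 0ℚ < Σ∈ p f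
Σ∈-pos {p = p} {f} {x} 0≤f x∈p 0<fx =
  <-≤-trans 0<fx (subst (_≤ Σ∈ p f) (Σ∈-⁅⁆ x f) (Σ∈-mono-⊆ 0≤f (x∈p⇒⁅x⁆⊆p x∈p)))

crossing : ∀ {P : ℕ → Set} → Decidable P → P 0 → ∀ k → ¬ P k → Σ ℕ λ s → s ℕ.< k × P s × ¬ P (suc s)
crossing P? P0 ℕ.zero  ¬Pk  = contradiction P0 ¬Pk
crossing P? P0 (suc k) ¬P1+k with P? k
... | yes Pk  = k , ℕ.n<1+n k , Pk , ¬P1+k
... | no  ¬Pk = let s , s<k , Ps , ¬P1+s = crossing P? P0 k ¬Pk in s , ℕ.m<n⇒m<1+n s<k , Ps , ¬P1+s

take-suc-lookup : ∀ {B : Set} (xs : List B) t .(t<∣xs∣ : t ℕ.< length xs) →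
                  take (suc t) xs ≡ take t xs ∷ʳ lookup xs (fromℕ< t<∣xs∣)
take-suc-lookup (x ∷ xs) ℕ.zero  _      = refl
take-suc-lookup (x ∷ xs) (suc t) t<∣xs∣ = cong (x ∷_) (take-suc-lookup xs t (ℕ.s<s⁻¹ t<∣xs∣))

sumℚ-∷ʳ : ∀ xs x → sumℚ (xs ∷ʳ x) ≡ sumℚ xs + x
sumℚ-∷ʳ []       x = trans (+-identityʳ x) (sym (+-identityˡ x))
sumℚ-∷ʳ (y ∷ xs) x = trans (cong (y +_) (sumℚ-∷ʳ xs x)) (sym (+-assoc y _ x))

sumℚ-take-suc : ∀ {B : Set} (xs : List B) (f : B → ℚ) (j : Fin (length xs)) →
                sumℚ (take (suc (toℕ j)) (map f xs)) ≡ sumℚ (take (toℕ j) (map f xs)) + f (lookup xs j)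
sumℚ-take-suc (x ∷ xs) f zero    = trans (+-identityʳ (f x)) (sym (+-identityˡ (f x)))
sumℚ-take-suc (x ∷ xs) f (suc j) = trans (cong (f x +_) (sumℚ-take-suc xs f j)) (sym (+-assoc (f x) _ _))

edgeSet : ∀ {m} → List (Fin m) → Subset m
edgeSet xs = ⋃ (map ⁅_⁆ xs)

edgeSet-∷ʳ : ∀ {m} (xs : List (Fin m)) x → edgeSet (xs ∷ʳ x) ≡ edgeSet xs ∪ ⁅ x ⁆
edgeSet-∷ʳ []       x = trans (∪-identityʳ ⁅ x ⁆) (sym (∪-identityˡ ⁅ x ⁆))
edgeSet-∷ʳ (y ∷ xs) x = trans (cong (⁅ y ⁆ ∪_) (edgeSet-∷ʳ xs x)) (sym (∪-assoc ⁅ y ⁆ (edgeSet xs) ⁅ x ⁆))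

edgeSet-take-mono : ∀ {m} (xs : List (Fin m)) {a t} → a ℕ.≤ t → edgeSet (take a xs) ⊆ edgeSet (take t xs)
edgeSet-take-mono xs       {ℕ.zero}           _           = ⊥⊆
edgeSet-take-mono []       {suc a} {suc t}    _           = id
edgeSet-take-mono (x ∷ xs) {suc a} {suc t}    (ℕ.s≤s a≤t) y∈ with x∈p∪q⁻ ⁅ x ⁆ _ y∈
... | inj₁ y∈x  = x∈p∪q⁺ (inj₁ y∈x)
... | inj₂ y∈xs = x∈p∪q⁺ (inj₂ (edgeSet-take-mono xs a≤t y∈xs))

module Greedy {n : ℕ} (G : Tree n) where
  open Tree G

  -- Prize, cost and excess

  c≥0 : ∀ i → 0ℚ ≤ c i
  c≥0 i = <⇒≤ (c>0 i)

  prizeE-nonNeg : ∀ E → 0ℚ ≤ prizeE G E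
  prizeE-nonNeg E = Σ∈-nonNeg E (p≥0 ∘ suc)

  costE-nonNeg : ∀ E → 0ℚ ≤ costE G E
  costE-nonNeg E = Σ∈-nonNeg E c≥0

  costE-pos : ∀ {E x} → x ∈ E → 0ℚ < costE G E
  costE-pos x∈E = Σ∈-pos c≥0 x∈E (c>0 _)

  costE≡0⇒prizeE≡0 : ∀ E → costE G E ≡ 0ℚ → prizeE G E ≡ 0ℚ
  costE≡0⇒prizeE≡0 E cost≡0 = ≤-antisym
    (subst (prizeE G E ≤_) (Σ∈-⊥ (p ∘ suc)) (Σ∈-mono-⊆ (p≥0 ∘ suc) E⊆⊥))
    (prizeE-nonNeg E)
    where
    E⊆⊥ : E ⊆ Subset.⊥
    E⊆⊥ x∈E = contradiction (sym cost≡0) (<⇒≢ (costE-pos x∈E))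

  prizeE≡dens*costE : ∀ E → prizeE G E ≡ dens G E * costE G E
  prizeE≡dens*costE E = ÷'-*-cancel (prizeE G E) (costE G E) (costE≡0⇒prizeE≡0 E)

  dens-nonNeg : ∀ E → 0ℚ ≤ dens G E
  dens-nonNeg E = ÷'-nonNeg (prizeE-nonNeg E) (costE-nonNeg E)

  excess : ℚ → Subset n → ℚ
  excess D E = prizeE G E - D * costE G E

  excess-⁅⁆ : ∀ D i → excess D ⁅ i ⁆ ≡ p (suc i) - D * c i
  excess-⁅⁆ D i = cong₂ (λ x y → x - D * y) (Σ∈-⁅⁆ i (p ∘ suc)) (Σ∈-⁅⁆ i c)

  excess-⊥ : ∀ D → excess D Subset.⊥ ≡ 0ℚ
  excess-⊥ D = begin
    prizeE G Subset.⊥ - D * costE G Subset.⊥ ≡⟨ cong₂ (λ x y → x - D * y) (Σ∈-⊥ (p ∘ suc)) (Σ∈-⊥ c) ⟩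
    0ℚ - D * 0ℚ                             ≡⟨ solve 1 (λ D → con 0ℚ :- D :* con 0ℚ := con 0ℚ) refl D ⟩
    0ℚ                                      ∎
    where open ≡-Reasoning

  excess-+ : ∀ D {E F H} → (∀ f → Σ∈ E f ≡ Σ∈ F f + Σ∈ H f) → excess D E ≡ excess D F + excess D H
  excess-+ D {E} {F} {H} additive = trans (cong₂ (λ x y → x - D * y) (additive (p ∘ suc)) (additive c))
    (solve 5 (λ D a b x y → (a :+ b) :- D :* (x :+ y) := (a :- D :* x) :+ (b :- D :* y)) refl
             D (prizeE G F) (prizeE G H) (costE G F) (costE G H))

  excess-∪ : ∀ D {E F} → Disjoint E F → excess D (E ∪ F) ≡ excess D E + excess D F
  excess-∪ D {E} {F} E#F = excess-+ D {E ∪ F} {E} {F} (λ f → Σ∈-∪ f E#F)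

  excess-split : ∀ D E F → excess D E ≡ excess D (E ∩ F) + excess D (E ─ F)
  excess-split D E F = excess-+ D {E} {E ∩ F} {E ─ F} (Σ∈-split E F)

  excess≤prizeE : ∀ {D} E → 0ℚ ≤ D → excess D E ≤ prizeE G E
  excess≤prizeE {D} E 0≤D = ≤-by-nonNeg-gap (prizeE G E) (0≤-* 0≤D (costE-nonNeg E))
    (solve 2 (λ P x → P := (P :- x) :+ x) refl (prizeE G E) (D * costE G E))

  excess-dens : ∀ E → excess (dens G E) E ≡ 0ℚ
  excess-dens E = trans (cong (_- dens G E * costE G E) (prizeE≡dens*costE E)) (+-inverseʳ (dens G E * costE G E))

  excess-change : ∀ D D' E → excess D E ≡ excess D' E + (D' - D) * costE G E
  excess-change D D' E = solve 4 (λ P C D D' → P :- D :* C := (P :- D' :* C) :+ (D' :- D) :* C) refl (prizeE G E) (costE G E) D D'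

  excess-antitone : ∀ {D D'} E → D ≤ D' → excess D' E ≤ excess D E
  excess-antitone {D} {D'} E D≤D' = ≤-by-nonNeg-gap _ (0≤-* (≤⇒0≤- D≤D') (costE-nonNeg E)) (excess-change D D' E)

  excess-strictly-antitone : ∀ {D D' E x} → x ∈ E → D < D' → excess D' E < excess D E
  excess-strictly-antitone {D} {D'} {E} x∈E D<D' = <-by-pos-gap _ (0<-* (<⇒0<- D<D') (costE-pos x∈E)) (excess-change D D' E)

  excess-shift : ∀ {D D'} E x → 0ℚ ≤ D → D ≤ D' → 0ℚ ≤ excess D' E + D' * x → 0ℚ ≤ excess D E + D * x
  excess-shift {D} {D'} E x 0≤D D≤D' 0≤bound' with ≤-total x (costE G E)
  ... | inj₁ x≤C = ≤-trans 0≤bound' (≤-by-nonNeg-gap (excess D E + D * x) (0≤-* (≤⇒0≤- D≤D') (≤⇒0≤- x≤C))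
    (solve 5 (λ P C D D' x → (P :- D :* C) :+ D :* x := ((P :- D' :* C) :+ D' :* x) :+ (D' :- D) :* (C :- x)) refl
             (prizeE G E) (costE G E) D D' x))
  ... | inj₂ C≤x = ≤-trans (prizeE-nonNeg E) (≤-by-nonNeg-gap (excess D E + D * x) (0≤-* 0≤D (≤⇒0≤- C≤x))
    (solve 4 (λ P C D x → (P :- D :* C) :+ D :* x := P :+ D :* (x :- C)) refl (prizeE G E) (costE G E) D x))

  -- Path costs and ancestors

  pathCost-fuel : ∀ f f' v → toℕ v ℕ.≤ f → toℕ v ℕ.≤ f' → pathCost G f v ≡ pathCost G f' v
  pathCost-fuel ℕ.zero    ℕ.zero     _       _ _ = refl
  pathCost-fuel ℕ.zero    (suc _)    zero    _ _ = refl
  pathCost-fuel (suc _)   ℕ.zero     zero    _ _ = refl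
  pathCost-fuel (suc _)   (suc _)    zero    _ _ = refl
  pathCost-fuel (suc f)   (suc f')   (suc i) (ℕ.s≤s i≤f) (ℕ.s≤s i≤f') =
    cong (c i +_) (pathCost-fuel f f' (par i) (ℕ.≤-trans (par≤ i) i≤f) (ℕ.≤-trans (par≤ i) i≤f'))

  ℓ-suc : ∀ i → ℓ G (suc i) ≡ c i + ℓ G (par i)
  ℓ-suc i = trans (pathCost-fuel n (suc (toℕ i)) (suc i) (toℕ<n i) ℕ.≤-refl)
    (cong (c i +_) (pathCost-fuel (toℕ i) n (par i) (par≤ i) (ℕ.≤-trans (par≤ i) (ℕ.<⇒≤ (toℕ<n i)))))

  ℓ-nonNeg : ∀ v → 0ℚ ≤ ℓ G v
  ℓ-nonNeg = pathCost-nonNeg n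
    where
    pathCost-nonNeg : ∀ f v → 0ℚ ≤ pathCost G f v
    pathCost-nonNeg ℕ.zero  _       = ≤-refl
    pathCost-nonNeg (suc f) zero    = ≤-refl
    pathCost-nonNeg (suc f) (suc i) = 0≤-+ (c≥0 i) (pathCost-nonNeg f (par i))

  ℓ≤χ : ∀ v → ℓ G v ≤ χ G
  ℓ≤χ v = subst (ℓ G v ≤_) (cong (foldr _⊔_ 0ℚ) (sym (map-tabulate id (ℓ G)))) (≤-foldr-⊔-tabulate (ℓ G) v)

  infix 4 _≼_

  data _≼_ (v : Fin (suc n)) : Fin (suc n) → Set where
    ≼-refl : v ≼ v
    ≼-par  : ∀ {i} → v ≼ par i → v ≼ suc i

  ≼-zero⁻ : ∀ {v} → v ≼ zero → v ≡ zero
  ≼-zero⁻ ≼-refl = refl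

  ≼-suc⁻ : ∀ {v i} → v ≼ suc i → v ≡ suc i ⊎ v ≼ par i
  ≼-suc⁻ ≼-refl      = inj₁ refl
  ≼-suc⁻ (≼-par v≼) = inj₂ v≼

  _≼?_ : ∀ v w → Dec (v ≼ w)
  v ≼? w = bounded v w (toℕ≤pred[n] w)
    where
    bounded : ∀ v w {f} → toℕ w ℕ.≤ f → Dec (v ≼ w)
    bounded v zero    _ = Dec.map′ (λ { refl → ≼-refl }) ≼-zero⁻ (v Fin.≟ zero)
    bounded v (suc i) {suc f} (ℕ.s≤s i≤f) =
      Dec.map′ [ (λ { refl → ≼-refl }) , ≼-par ]′ ≼-suc⁻
               (v Fin.≟ suc i ⊎-dec bounded v (par i) (ℕ.≤-trans (par≤ i) i≤f))

  ≼⇒ℓ≤ℓ : ∀ {v w} → v ≼ w → ℓ G v ≤ ℓ G w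
  ≼⇒ℓ≤ℓ ≼-refl           = ≤-refl
  ≼⇒ℓ≤ℓ (≼-par {i} v≼) =
    ≤-trans (≼⇒ℓ≤ℓ v≼) (≤-by-nonNeg-gap (ℓ G (suc i)) (c≥0 i) (trans (ℓ-suc i) (+-comm (c i) _)))

  -- Rooted subtrees and min-max subtrees

  -- the root and the child endpoints of the edges in A
  vertices : Subset n → Subset (suc n)
  vertices A = inside ∷ A

  vertices-mono : ∀ {A B} → A ⊆ B → vertices A ⊆ vertices B
  vertices-mono A⊆B here        = here
  vertices-mono A⊆B (there j∈A) = there (A⊆B j∈A)

  Closed : Subset n → Set
  Closed A = ∀ {i} → i ∈ A → par i ∈ vertices A

  -- Y spans a rooted subtree of G contracted along A
  Rooted : Subset n → Subset n → Set
  Rooted A Y = ∀ {i} → i ∈ Y → i ∉ A × par i ∈ vertices (A ∪ Y)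

  Closed-⊥ : Closed Subset.⊥
  Closed-⊥ i∈⊥ = contradiction i∈⊥ ∉⊥

  Closed-∪⁅⁆ : ∀ {A e} → Closed A → par e ∈ vertices A → Closed (A ∪ ⁅ e ⁆)
  Closed-∪⁅⁆ {A} {e} closed par-e i∈A∪e with x∈p∪q⁻ A ⁅ e ⁆ i∈A∪e
  ... | inj₁ i∈A = vertices-mono (p⊆p∪q _) (closed i∈A)
  ... | inj₂ i∈e rewrite x∈⁅y⁆⇒x≡y e i∈e = vertices-mono (p⊆p∪q _) par-e

  Closed⇒Rooted-─ : ∀ {A B} → Closed B → A ⊆ B → Rooted A (B ─ A)
  Closed⇒Rooted-─ {A} {B} closed A⊆B i∈B─A =
    x∈p─q⇒x∉q i∈B─A , vertices-mono ⊆-∪-─ (closed (p─q⊆p B A i∈B─A))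

  Rooted-─ : ∀ {A A' Y} → Rooted A Y → A ⊆ A' → Rooted A' (Y ─ A')
  Rooted-─ {A} {A'} {Y} rooted A⊆A' i∈Y─A' =
    x∈p─q⇒x∉q i∈Y─A' , vertices-mono A∪Y⊆ (proj₂ (rooted (p─q⊆p Y A' i∈Y─A')))
    where
    A∪Y⊆ : A ∪ Y ⊆ A' ∪ (Y ─ A')
    A∪Y⊆ j∈A∪Y with x∈p∪q⁻ A Y j∈A∪Y
    ... | inj₁ j∈A = x∈p∪q⁺ (inj₁ (A⊆A' j∈A))
    ... | inj₂ j∈Y = ⊆-∪-─ j∈Y

  Rooted-∪ : ∀ {A A' Y U} → Rooted A Y → Rooted A' U → A ⊆ A' → A' ⊆ A ∪ Y → Rooted A (Y ∪ U)
  Rooted-∪ {A} {A'} {Y} {U} rootedY rootedU A⊆A' A'⊆A∪Y i∈Y∪U with x∈p∪q⁻ Y U i∈Y∪U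
  ... | inj₁ i∈Y = let i∉A , par-i = rootedY i∈Y in i∉A , vertices-mono A∪Y⊆ par-i
    where
    A∪Y⊆ : A ∪ Y ⊆ A ∪ (Y ∪ U)
    A∪Y⊆ j∈A∪Y with x∈p∪q⁻ A Y j∈A∪Y
    ... | inj₁ j∈A = x∈p∪q⁺ (inj₁ j∈A)
    ... | inj₂ j∈Y = x∈p∪q⁺ (inj₂ (x∈p∪q⁺ (inj₁ j∈Y)))
  ... | inj₂ i∈U = let i∉A' , par-i = rootedU i∈U in i∉A' ∘ A⊆A' , vertices-mono A'∪U⊆ par-i
    where
    A'∪U⊆ : A' ∪ U ⊆ A ∪ (Y ∪ U)
    A'∪U⊆ j∈A'∪U with x∈p∪q⁻ A' U j∈A'∪U
    ... | inj₂ j∈U = x∈p∪q⁺ (inj₂ (x∈p∪q⁺ (inj₂ j∈U)))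
    ... | inj₁ j∈A' with x∈p∪q⁻ A Y (A'⊆A∪Y j∈A')
    ...   | inj₁ j∈A = x∈p∪q⁺ (inj₁ j∈A)
    ...   | inj₂ j∈Y = x∈p∪q⁺ (inj₂ (x∈p∪q⁺ (inj₁ j∈Y)))

  Rooted-∩ : ∀ {A A' Y Z} → Rooted A' Z → Rooted A Y → A ⊆ A' → Rooted A' (Z ∩ Y)
  Rooted-∩ {A} {A'} {Y} {Z} rootedZ rootedY A⊆A' i∈Z∩Y =
    let i∈Z , i∈Y = x∈p∩q⁻ Z Y i∈Z∩Y in
    proj₁ (rootedZ i∈Z) , both (proj₂ (rootedZ i∈Z)) (proj₂ (rootedY i∈Y))
    where
    both : ∀ {v} → v ∈ vertices (A' ∪ Z) → v ∈ vertices (A ∪ Y) → v ∈ vertices (A' ∪ (Z ∩ Y))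
    both here           here          = here
    both (there j∈A'∪Z) (there j∈A∪Y) with x∈p∪q⁻ A' Z j∈A'∪Z | x∈p∪q⁻ A Y j∈A∪Y
    ... | inj₁ j∈A' | _         = there (x∈p∪q⁺ (inj₁ j∈A'))
    ... | inj₂ _    | inj₁ j∈A  = there (x∈p∪q⁺ (inj₁ (A⊆A' j∈A)))
    ... | inj₂ j∈Z  | inj₂ j∈Y  = there (x∈p∪q⁺ (inj₂ (x∈p∩q⁺ (j∈Z , j∈Y))))

  Rooted⇒IsRootedC : ∀ {A Y} → Rooted A Y → IsRootedC G (vertices A) Y
  Rooted⇒IsRootedC {A} {Y} rooted =
    (λ _ i∈Y → proj₁ (rooted i∈Y) ∘ drop-there) , (λ _ i∈Y → split (proj₂ (rooted i∈Y)))
    where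
    split : ∀ {v} → v ∈ vertices (A ∪ Y) → v ∈ vertices A ⊎ Σ (Fin n) (λ j → v ≡ suc j × j ∈ Y)
    split here = inj₁ here
    split (there j∈A∪Y) with x∈p∪q⁻ A Y j∈A∪Y
    ... | inj₁ j∈A = inj₁ (there j∈A)
    ... | inj₂ j∈Y = inj₂ (_ , refl , j∈Y)

  IsRootedC⇒Rooted : ∀ {A Y} → IsRootedC G (vertices A) Y → Rooted A Y
  IsRootedC⇒Rooted {A} {Y} (suc∉ , par∈) i∈Y = suc∉ _ i∈Y ∘ there , merge (par∈ _ i∈Y)
    where
    merge : ∀ {v} → v ∈ vertices A ⊎ Σ (Fin n) (λ j → v ≡ suc j × j ∈ Y) → v ∈ vertices (A ∪ Y)
    merge (inj₁ v∈A)              = vertices-mono (p⊆p∪q Y) v∈A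
    merge (inj₂ (_ , refl , j∈Y)) = there (x∈p∪q⁺ (inj₂ j∈Y))

  ancestor-closed : ∀ {A v w} → Closed A → v ≼ w → w ∈ vertices A → v ∈ vertices A
  ancestor-closed closed ≼-refl         w∈A         = w∈A
  ancestor-closed closed (≼-par v≼par) (there i∈A) = ancestor-closed closed v≼par (closed i∈A)

  below : Fin n → Subset n
  below e = subsetOf (λ i → suc e ≼? suc i)

  Rooted-∩-below : ∀ {A Y e} → Closed A → Rooted A Y → e ∈ Y → par e ∈ vertices A → Rooted A (Y ∩ below e)
  Rooted-∩-below {A} {Y} {e} closed rooted e∈Y par-e {i} i∈Y∩below with x∈p∩q⁻ Y (below e) i∈Y∩below | i Fin.≟ e
  ... | _   , _       | yes refl = proj₁ (rooted e∈Y) , vertices-mono (p⊆p∪q _) par-e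
  ... | i∈Y , i∈below | no  i≢e with ≼-suc⁻ (∈-subsetOf⁻ _ i∈below)
  ...   | inj₁ e≡i   = contradiction (suc-injective (sym e≡i)) i≢e
  ...   | inj₂ e≼par = proj₁ (rooted i∈Y) , lift e≼par (proj₂ (rooted i∈Y))
    where
    lift : ∀ {v} → suc e ≼ v → v ∈ vertices (A ∪ Y) → v ∈ vertices (A ∪ (Y ∩ below e))
    lift e≼v here = contradiction (≼-zero⁻ e≼v) λ ()
    lift e≼v (there j∈A∪Y) with x∈p∪q⁻ A Y j∈A∪Y
    ... | inj₁ j∈A = contradiction (drop-there (ancestor-closed closed e≼v (there j∈A))) (proj₁ (rooted e∈Y))
    ... | inj₂ j∈Y = there (x∈p∪q⁺ (inj₂ (x∈p∩q⁺ (j∈Y , ∈-subsetOf⁺ _ e≼v))))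

  Rooted-─-below : ∀ {A Y e} → Rooted A Y → Rooted A (Y ─ below e)
  Rooted-─-below {A} {Y} {e} rooted {i} i∈Y─below = proj₁ (rooted i∈Y) , lift ≼-par (proj₂ (rooted i∈Y))
    where
    i∈Y = p─q⊆p Y (below e) i∈Y─below
    lift : ∀ {v} → (suc e ≼ v → suc e ≼ suc i) → v ∈ vertices (A ∪ Y) → v ∈ vertices (A ∪ (Y ─ below e))
    lift _ here = here
    lift e≼v⇒e≼i (there j∈A∪Y) with x∈p∪q⁻ A Y j∈A∪Y
    ... | inj₁ j∈A = there (x∈p∪q⁺ (inj₁ j∈A))
    ... | inj₂ j∈Y with suc e ≼? _
    ...   | yes e≼j = contradiction (∈-subsetOf⁺ _ (e≼v⇒e≼i e≼j)) (x∈p─q⇒x∉q i∈Y─below)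
    ...   | no  e⋠j = there (x∈p∪q⁺ (inj₂ (x∈p∧x∉q⇒x∈p─q j∈Y (e⋠j ∘ ∈-subsetOf⁻ _))))

  vertices-edgeSet⊆rootedBy : ∀ xs → vertices (edgeSet xs) ⊆ rootedBy G xs
  vertices-edgeSet⊆rootedBy []       v∈ = v∈
  vertices-edgeSet⊆rootedBy (x ∷ xs) here = x∈p∪q⁺ (inj₂ (x∈p∪q⁺ (inj₂ (vertices-edgeSet⊆rootedBy xs here))))
  vertices-edgeSet⊆rootedBy (x ∷ xs) (there j∈) with x∈p∪q⁻ ⁅ x ⁆ (edgeSet xs) j∈
  ... | inj₁ j∈x  rewrite x∈⁅y⁆⇒x≡y x j∈x = x∈p∪q⁺ (inj₁ (x∈⁅x⁆ (suc x)))
  ... | inj₂ j∈xs = x∈p∪q⁺ (inj₂ (x∈p∪q⁺ (inj₂ (vertices-edgeSet⊆rootedBy xs (there j∈xs)))))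

  rootedBy⊆vertices : ∀ {E} xs → edgeSet xs ⊆ E → All (λ e → par e ∈ vertices E) xs → rootedBy G xs ⊆ vertices E
  rootedBy⊆vertices [] _ _ v∈ = subst (_∈ vertices _) (sym (x∈⁅y⁆⇒x≡y zero v∈)) here
  rootedBy⊆vertices (x ∷ xs) xs⊆E (par-x ∷ pars) v∈ with x∈p∪q⁻ ⁅ suc x ⁆ _ v∈
  ... | inj₁ v∈sx = subst (_∈ vertices _) (sym (x∈⁅y⁆⇒x≡y (suc x) v∈sx))
                          (there (xs⊆E (x∈p∪q⁺ (inj₁ (x∈⁅x⁆ x)))))
  ... | inj₂ v∈rest with x∈p∪q⁻ ⁅ par x ⁆ _ v∈rest
  ...   | inj₁ v∈px = subst (_∈ vertices _) (sym (x∈⁅y⁆⇒x≡y (par x) v∈px)) par-x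
  ...   | inj₂ v∈xs = rootedBy⊆vertices xs (xs⊆E ∘ x∈p∪q⁺ ∘ inj₂) pars v∈xs

  prizeE≤Σ∈vertices : ∀ E → prizeE G E ≤ Σ∈ (vertices E) p
  prizeE≤Σ∈vertices E = ≤-by-nonNeg-gap (Σ∈ (vertices E) p) (p≥0 zero) (trans (Σ∈-∷ inside E p) (+-comm (p zero) _))

  module MinMax {A Y : Subset n} (minmax : IsMinMax G (vertices A) Y) where

    rooted : Rooted A Y
    rooted = IsRootedC⇒Rooted (proj₁ minmax)

    excess-nonPos : ∀ {Q} → Rooted A Q → excess (dens G Y) Q ≤ 0ℚ
    excess-nonPos {Q} rootedQ = subst (excess (dens G Y) Q ≤_) (excess-dens Q)
      (excess-antitone Q (proj₁ (proj₂ minmax) Q (Rooted⇒IsRootedC rootedQ)))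

    excess-neg : ∀ {Q} → Rooted A Q → Q ⊂ Y → Nonempty Q → excess (dens G Y) Q < 0ℚ
    excess-neg {Q} rootedQ (Q⊆Y , x , x∈Y , x∉Q) (z , z∈Q) with <-cmp (dens G Q) (dens G Y)
    ... | tri< dQ<dY _ _ = subst (excess (dens G Y) Q <_) (excess-dens Q) (excess-strictly-antitone z∈Q dQ<dY)
    ... | tri≈ _ dQ≡dY _ =
      contradiction (subst (x ∈_) (sym (proj₂ (proj₂ minmax) Q (Rooted⇒IsRootedC rootedQ) Q⊆Y dQ≡dY)) x∈Y) x∉Q
    ... | tri> _ _ dQ>dY = contradiction (proj₁ (proj₂ minmax) Q (Rooted⇒IsRootedC rootedQ)) (<⇒≱ dQ>dY)

    excess≡0 : excess (dens G Y) Y ≡ 0ℚ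
    excess≡0 = excess-dens Y

    Y⊆below-top : ∀ {e} → Closed A → e ∈ Y → par e ∈ vertices A → Y ⊆ below e
    Y⊆below-top {e} closed e∈Y par-e {x} x∈Y with x ∈? below e
    ... | yes x∈below = x∈below
    ... | no  x∉below = contradiction (trans (sym (excess-split (dens G Y) Y (below e))) excess≡0)
                                      (<⇒≢ (+-mono-< inside<0 outside<0))
      where
      e∈below : e ∈ below e
      e∈below = ∈-subsetOf⁺ _ ≼-refl
      inside<0 : excess (dens G Y) (Y ∩ below e) < 0ℚ
      inside<0 = excess-neg (Rooted-∩-below closed rooted e∈Y par-e)
        (p∩q⊆p Y (below e) , x , x∈Y , x∉below ∘ proj₂ ∘ x∈p∩q⁻ Y (below e)) (e , x∈p∩q⁺ (e∈Y , e∈below))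
      outside<0 : excess (dens G Y) (Y ─ below e) < 0ℚ
      outside<0 = excess-neg (Rooted-─-below rooted)
        (p─q⊆p Y (below e) , e , e∈Y , (λ e∈ → x∈p─q⇒x∉q e∈ e∈below))
        (x , x∈p∧x∉q⇒x∈p─q x∈Y x∉below)

  module Run (X : Execution G) where
    open Execution X using (π; step; stop) renaming (Y to chosenAt)

    L : ℕ
    L = length π

    A : ℕ → Subset n
    A t = edgeSet (take t π)

    edge : ∀ t → .(t ℕ.< L) → Fin n
    edge t t<L = lookup π (fromℕ< t<L)

    chosen : ∀ t → .(t ℕ.< L) → Subset n
    chosen t t<L = chosenAt (fromℕ< t<L)

    density : ∀ t → .(t ℕ.< L) → ℚ
    density t t<L = dens G (chosen t t<L)

    A-suc : ∀ t .(t<L : t ℕ.< L) → A (suc t) ≡ A t ∪ ⁅ edge t t<L ⁆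
    A-suc t t<L = trans (cong edgeSet (take-suc-lookup π t t<L)) (edgeSet-∷ʳ (take t π) _)

    A-mono : ∀ {a t} → a ℕ.≤ t → A a ⊆ A t
    A-mono = edgeSet-take-mono π

    private
      Tb : ℕ → Subset (suc n)
      Tb t = rootedBy G (take t π)

      at-iteration : ∀ t .(t<L : t ℕ.< L) →
        (totalPrizeC G (Tb t) ≢ 0ℚ) × IsMinMax G (Tb t) (chosen t t<L) ×
        (edge t t<L ∈ chosen t t<L) × (par (edge t t<L) ∈ Tb t)
      at-iteration t t<L = subst (λ s → (totalPrizeC G (Tb s) ≢ 0ℚ) × IsMinMax G (Tb s) (chosen t t<L) ×
                                         (edge t t<L ∈ chosen t t<L) × (par (edge t t<L) ∈ Tb s))
                                 (toℕ-fromℕ< t<L) (step (fromℕ< t<L))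

      parents-in : ∀ t → t ℕ.≤ L → All (λ e → par e ∈ vertices (A t)) (take t π)
      parents-in ℕ.zero  _   = []
      parents-in (suc t) t<L = subst (All (λ e → par e ∈ vertices (A (suc t)))) (sym (take-suc-lookup π t t<L))
        (∷ʳ⁺ (All.map (vertices-mono A-step) earlier) (vertices-mono A-step par-edge))
        where
        A-step = A-mono (ℕ.n≤1+n t)
        earlier = parents-in t (ℕ.<⇒≤ t<L)
        par-edge = rootedBy⊆vertices (take t π) id earlier (proj₂ (proj₂ (proj₂ (at-iteration t t<L))))

    rootedBy-take≡vertices : ∀ t → t ℕ.≤ L → rootedBy G (take t π) ≡ vertices (A t)
    rootedBy-take≡vertices t t≤L =
      ⊆-antisym (rootedBy⊆vertices (take t π) id (parents-in t t≤L)) (vertices-edgeSet⊆rootedBy (take t π))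

    minmax : ∀ t (t<L : t ℕ.< L) → IsMinMax G (vertices (A t)) (chosen t t<L)
    minmax t t<L = subst (λ T → IsMinMax G T (chosen t t<L)) (rootedBy-take≡vertices t (ℕ.<⇒≤ t<L))
                         (proj₁ (proj₂ (at-iteration t t<L)))

    edge∈chosen : ∀ t .(t<L : t ℕ.< L) → edge t t<L ∈ chosen t t<L
    edge∈chosen t t<L = proj₁ (proj₂ (proj₂ (at-iteration t t<L)))

    par-edge : ∀ t (t<L : t ℕ.< L) → par (edge t t<L) ∈ vertices (A t)
    par-edge t t<L = subst (par (edge t t<L) ∈_) (rootedBy-take≡vertices t (ℕ.<⇒≤ t<L))
                           (proj₂ (proj₂ (proj₂ (at-iteration t t<L))))

    edge∉A : ∀ t (t<L : t ℕ.< L) → edge t t<L ∉ A t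
    edge∉A t t<L = proj₁ (MinMax.rooted (minmax t t<L) (edge∈chosen t t<L))

    A-closed : ∀ t → t ℕ.≤ L → Closed (A t)
    A-closed ℕ.zero  _   = Closed-⊥
    A-closed (suc t) t<L = subst Closed (sym (A-suc t t<L)) (Closed-∪⁅⁆ (A-closed t (ℕ.<⇒≤ t<L)) (par-edge t t<L))

    Σ∈-A-suc : ∀ t (t<L : t ℕ.< L) (f : Fin n → ℚ) → Σ∈ (A (suc t)) f ≡ Σ∈ (A t) f + f (edge t t<L)
    Σ∈-A-suc t t<L f = trans (cong (λ E → Σ∈ E f) (A-suc t t<L)) (Σ∈-∪⁅⁆ f (edge∉A t t<L))

    costE-A-mono : ∀ {a t} → a ℕ.≤ t → costE G (A a) ≤ costE G (A t)
    costE-A-mono a≤t = Σ∈-mono-⊆ c≥0 (A-mono a≤t)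

    costE-A : ∀ t → t ℕ.≤ L → sumℚ (take t (map c π)) ≡ costE G (A t)
    costE-A t t≤L = trans (cong sumℚ (take-map t π)) (prefix t t≤L)
      where
      prefix : ∀ t → t ℕ.≤ L → sumℚ (map c (take t π)) ≡ costE G (A t)
      prefix ℕ.zero  _   = sym (Σ∈-⊥ c)
      prefix (suc t) t<L = begin
        sumℚ (map c (take (suc t) π))            ≡⟨ cong (sumℚ ∘ map c) (take-suc-lookup π t t<L) ⟩
        sumℚ (map c (take t π ∷ʳ edge t t<L))    ≡⟨ cong sumℚ (map-++ c (take t π) _) ⟩
        sumℚ (map c (take t π) ∷ʳ c (edge t t<L)) ≡⟨ sumℚ-∷ʳ (map c (take t π)) _ ⟩
        sumℚ (map c (take t π)) + c (edge t t<L)  ≡⟨ cong (_+ c (edge t t<L)) (prefix t (ℕ.<⇒≤ t<L)) ⟩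
        costE G (A t) + c (edge t t<L)            ≡⟨ sym (Σ∈-A-suc t t<L c) ⟩
        costE G (A (suc t))                       ∎
        where open ≡-Reasoning

    prizeE-outside : ∀ {R} → Disjoint R (A L) → prizeE G R ≤ 0ℚ
    prizeE-outside {R} R#A = subst (prizeE G R ≤_) outside≡0 (Σ∈-mono-⊆ (p≥0 ∘ suc) (x∉p⇒x∈∁p ∘ R#A))
      where
      outside≡0 : Σ∈ (∁ (A L)) (p ∘ suc) ≡ 0ℚ
      outside≡0 = begin
        Σ∈ (∁ (A L)) (p ∘ suc)                         ≡⟨ sym (+-identityˡ _) ⟩
        0ℚ + Σ∈ (∁ (A L)) (p ∘ suc)                    ≡⟨ sym (Σ∈-∷ outside (∁ (A L)) p) ⟩
        totalPrizeC G (vertices (A L))                  ≡⟨ cong (totalPrizeC G) (sym (rootedBy-take≡vertices L ℕ.≤-refl)) ⟩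
        totalPrizeC G (rootedBy G (take L π))           ≡⟨ cong (totalPrizeC G ∘ rootedBy G) (take-all L π ℕ.≤-refl) ⟩
        totalPrizeC G (rootedBy G π)                    ≡⟨ stop ⟩
        0ℚ                                              ∎
        where open ≡-Reasoning

    edge∈algEdges : ∀ B acc (l : List (Fin n)) u .(u<∣l∣ : u ℕ.< length l) →
                    acc + sumℚ (take (suc u) (map c l)) ≤ B → lookup l (fromℕ< u<∣l∣) ∈ edgeSet (algEdges G X B acc l)
    edge∈algEdges B acc (x ∷ l) ℕ.zero  _ within with (acc + c x) ≤? B
    ... | yes _      = x∈p∪q⁺ (inj₁ (x∈⁅x⁆ x))
    ... | no  ¬first = contradiction (subst (_≤ B) (cong (acc +_) (+-identityʳ (c x))) within) ¬first
    edge∈algEdges B acc (x ∷ l) (suc u) u<∣l∣ within with (acc + c x) ≤? B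
    ... | yes _ = x∈p∪q⁺ (inj₂ (edge∈algEdges B (acc + c x) l u (ℕ.s<s⁻¹ u<∣l∣)
                                 (subst (_≤ B) (sym (+-assoc acc (c x) _)) within)))
    ... | no  _ = edge∈algEdges B (acc + c x) l u (ℕ.s<s⁻¹ u<∣l∣) (subst (_≤ B) (sym (+-assoc acc (c x) _)) within)

    A⊆algEdges : ∀ B t → t ℕ.≤ L → costE G (A t) ≤ B → A t ⊆ edgeSet (algEdges G X B 0ℚ π)
    A⊆algEdges B ℕ.zero  _   _      = ⊥⊆
    A⊆algEdges B (suc t) t<L cost≤B {i} i∈A with x∈p∪q⁻ (A t) _ (subst (i ∈_) (A-suc t t<L) i∈A)
    ... | inj₁ i∈At = A⊆algEdges B t (ℕ.<⇒≤ t<L) (≤-trans (costE-A-mono (ℕ.n≤1+n t)) cost≤B) i∈At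
    ... | inj₂ i∈e  = subst (_∈ _) (sym (x∈⁅y⁆⇒x≡y _ i∈e))
      (edge∈algEdges B 0ℚ π t t<L (subst (_≤ B) (sym (trans (+-identityˡ _) (costE-A (suc t) t<L))) cost≤B))

    prizeE-A≤pAlg : ∀ t → t ℕ.≤ L → ∀ B → costE G (A t) ≤ B → prizeE G (A t) ≤ pAlg G X B
    prizeE-A≤pAlg t t≤L B cost≤B = begin
      prizeE G (A t)                    ≤⟨ Σ∈-mono-⊆ (p≥0 ∘ suc) (A⊆algEdges B t t≤L cost≤B) ⟩
      prizeE G (edgeSet algorithmEdges) ≤⟨ prizeE≤Σ∈vertices (edgeSet algorithmEdges) ⟩
      Σ∈ (vertices (edgeSet algorithmEdges)) p ≤⟨ Σ∈-mono-⊆ p≥0 (vertices-edgeSet⊆rootedBy algorithmEdges) ⟩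
      pAlg G X B                        ∎
      where
      open ≤-Reasoning
      algorithmEdges = algEdges G X B 0ℚ π

    between : ℕ → ℕ → Subset n
    between a t = A t ─ A a

    between-rooted : ∀ {a t} → a ℕ.≤ t → t ℕ.≤ L → Rooted (A a) (between a t)
    between-rooted a≤t t≤L = Closed⇒Rooted-─ (A-closed _ t≤L) (A-mono a≤t)

    between-suc : ∀ {a t} (t<L : t ℕ.< L) → a ℕ.≤ t → between a (suc t) ≡ between a t ∪ ⁅ edge t t<L ⁆
    between-suc {a} {t} t<L a≤t =
      trans (cong (_─ A a) (A-suc t t<L)) (─-∪⁅⁆ (A t) (A a) (edge∉A t t<L ∘ A-mono a≤t))

    Σ∈-A-between : ∀ {a t} (f : Fin n → ℚ) → a ℕ.≤ t → Σ∈ (A t) f ≡ Σ∈ (A a) f + Σ∈ (between a t) f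
    Σ∈-A-between {a} {t} f a≤t =
      trans (Σ∈-split (A t) (A a) f) (cong (λ E → Σ∈ E f + Σ∈ (between a t) f) (⊆⇒∩≡ (A-mono a≤t)))

    Σ∈-between : ∀ {a b t} (f : Fin n → ℚ) → a ℕ.≤ b → b ℕ.≤ t →
                 Σ∈ (between a t) f ≡ Σ∈ (between a b) f + Σ∈ (between b t) f
    Σ∈-between {a} {b} {t} f a≤b b≤t = +-cancelˡ-≡ (Σ∈ (A a) f) (begin
      Σ∈ (A a) f + Σ∈ (between a t) f                         ≡⟨ sym (Σ∈-A-between f (ℕ.≤-trans a≤b b≤t)) ⟩
      Σ∈ (A t) f                                              ≡⟨ Σ∈-A-between f b≤t ⟩
      Σ∈ (A b) f + Σ∈ (between b t) f                         ≡⟨ cong (_+ Σ∈ (between b t) f) (Σ∈-A-between f a≤b) ⟩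
      (Σ∈ (A a) f + Σ∈ (between a b) f) + Σ∈ (between b t) f ≡⟨ +-assoc (Σ∈ (A a) f) _ _ ⟩
      Σ∈ (A a) f + (Σ∈ (between a b) f + Σ∈ (between b t) f) ∎)
      where open ≡-Reasoning

    between-self-empty : ∀ {a E} → between a a ⊆ E
    between-self-empty {a} x∈ = contradiction (p─q⊆p (A a) (A a) x∈) (x∈p─q⇒x∉q x∈)

    excess-between-self : ∀ D a → excess D (between a a) ≡ 0ℚ
    excess-between-self D a = trans (cong (excess D) (⊆-antisym (between-self-empty {a}) ⊥⊆)) (excess-⊥ D)

    excess-between : ∀ D {a b t} → a ℕ.≤ b → b ℕ.≤ t →
                     excess D (between a t) ≡ excess D (between a b) + excess D (between b t)
    excess-between D {a} {b} {t} a≤b b≤t = excess-+ D {between a t} {between a b} {between b t} (λ f → Σ∈-between f a≤b b≤t)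

    excess-between-suc : ∀ D {a t} (t<L : t ℕ.< L) → a ℕ.≤ t →
      excess D (between a (suc t)) ≡ excess D (between a t) + (p (suc (edge t t<L)) - D * c (edge t t<L))
    excess-between-suc D {a} {t} t<L a≤t = begin
      excess D (between a (suc t))                      ≡⟨ cong (excess D) (between-suc t<L a≤t) ⟩
      excess D (between a t ∪ ⁅ edge t t<L ⁆)           ≡⟨ excess-∪ D S#e ⟩
      excess D (between a t) + excess D ⁅ edge t t<L ⁆  ≡⟨ cong (excess D (between a t) +_) (excess-⁅⁆ D _) ⟩
      excess D (between a t) + (p (suc (edge t t<L)) - D * c (edge t t<L)) ∎
      where
      open ≡-Reasoning
      S#e : Disjoint (between a t) ⁅ edge t t<L ⁆
      S#e x∈S x∈e = edge∉A t t<L (subst (_∈ A t) (x∈⁅y⁆⇒x≡y _ x∈e) (p─q⊆p (A t) (A a) x∈S))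

    -- Blocks

    module Block (a : ℕ) (a<L : a ℕ.< L) where
      Y : Subset n
      Y = chosen a a<L

      D : ℚ
      D = density a a<L

      size : ℕ
      size = ∣ Y ∣

      open MinMax (minmax a a<L)

      record Invariant (s : ℕ) : Set where
        field
          running  : a ℕ.+ s ℕ.≤ L
          picked⊆Y : between a (a ℕ.+ s) ⊆ Y
          ∣picked∣ : ∣ between a (a ℕ.+ s) ∣ ≡ s

      edge-a∈between : ∀ {t} → a ℕ.< t → edge a a<L ∈ between a t
      edge-a∈between a<t = x∈p∧x∉q⇒x∈p─q
        (A-mono a<t (subst (edge a a<L ∈_) (sym (A-suc a a<L)) (x∈p∪q⁺ (inj₂ (x∈⁅x⁆ _)))))
        (edge∉A a a<L)

      module _ {s} (s<size : s ℕ.< size) (inv : Invariant s) where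
        open Invariant inv
        private
          t = a ℕ.+ s
          a≤t = ℕ.m≤m+n a s

        Y∩A≡between : Y ∩ A t ≡ between a t
        Y∩A≡between = ⊆-antisym
          (λ x∈ → let x∈Y , x∈A = x∈p∩q⁻ Y (A t) x∈ in x∈p∧x∉q⇒x∈p─q x∈A (proj₁ (rooted x∈Y)))
          (λ x∈S → x∈p∩q⁺ (picked⊆Y x∈S , p─q⊆p (A t) (A a) x∈S))

        unpicked-nonempty : Nonempty (Y ─ A t)
        unpicked-nonempty with nonempty? (Y ─ A t)
        ... | yes ne    = ne
        ... | no  empty = contradiction (subst (size ℕ.≤_) ∣picked∣ (p⊆q⇒∣p∣≤∣q∣ Y⊆S)) (ℕ.<⇒≱ s<size)
          where
          Y⊆S : Y ⊆ between a t
          Y⊆S {x} x∈Y with x ∈? A t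
          ... | yes x∈A = x∈p∧x∉q⇒x∈p─q x∈A (proj₁ (rooted x∈Y))
          ... | no  x∉A = contradiction (x , x∈p∧x∉q⇒x∈p─q x∈Y x∉A) empty

        excess-unpicked-pos : 1 ℕ.≤ s → 0ℚ < excess D (Y ─ A t)
        excess-unpicked-pos 1≤s = +≡0∧<0⇒0< Y-splits excess-picked-neg
          where
          x = proj₁ unpicked-nonempty
          x∈Y─A = proj₂ unpicked-nonempty
          excess-picked-neg : excess D (between a t) < 0ℚ
          excess-picked-neg = excess-neg (between-rooted a≤t running)
            (picked⊆Y , x , p─q⊆p Y (A t) x∈Y─A , x∈p─q⇒x∉q x∈Y─A ∘ p─q⊆p (A t) (A a))
            (edge a a<L , edge-a∈between (ℕ.m<m+n a 1≤s))
          Y-splits : excess D (between a t) + excess D (Y ─ A t) ≡ 0ℚ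
          Y-splits = trans (cong (λ E → excess D E + excess D (Y ─ A t)) (sym Y∩A≡between))
                           (trans (sym (excess-split D Y (A t))) excess≡0)

        -- after the last iteration the unpicked edges carry no prize
        still-running : 1 ℕ.≤ s → t ℕ.< L
        still-running 1≤s with ℕ.m≤n⇒m<n∨m≡n running
        ... | inj₁ t<L = t<L
        ... | inj₂ t≡L = contradiction (≤-trans (excess≤prizeE (Y ─ A t) (dens-nonNeg Y)) (prizeE-outside unpicked#A))
                                       (<⇒≱ (excess-unpicked-pos 1≤s))
          where
          unpicked#A : Disjoint (Y ─ A t) (A L)
          unpicked#A x∈ = x∈p─q⇒x∉q x∈ ∘ subst (λ u → _ ∈ A u) (sym t≡L)

        density-increases : (1≤s : 1 ℕ.≤ s) → D < density t (still-running 1≤s)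
        density-increases 1≤s = ≰⇒> λ D'≤D → <⇒≱ (excess-unpicked-pos 1≤s)
          (≤-trans (excess-antitone (Y ─ A t) D'≤D)
                   (MinMax.excess-nonPos (minmax t (still-running 1≤s)) (Rooted-─ rooted (A-mono a≤t))))

        -- Y' ─ Y has excess ≤ 0 at D, as Y ∪ Y' is rooted over A a, and ≥ 0 at D' > D,
        -- as Y' ∩ Y is rooted over A t; so it is empty.
        chosen⊆Y : (1≤s : 1 ℕ.≤ s) → chosen t (still-running 1≤s) ⊆ Y
        chosen⊆Y 1≤s {x} x∈Y' with x ∈? Y
        ... | yes x∈Y = x∈Y
        ... | no  x∉Y = contradiction (≤-trans excess-new≤0 excess'-new≥0)
          (<⇒≱ (excess-strictly-antitone (x∈p∧x∉q⇒x∈p─q x∈Y' x∉Y) (density-increases 1≤s)))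
          where
          t<L = still-running 1≤s
          Y' = chosen t t<L
          D' = density t t<L
          module M' = MinMax (minmax t t<L)

          A⊆A∪Y : A t ⊆ A a ∪ Y
          A⊆A∪Y {x} x∈A with x ∈? A a
          ... | yes x∈Aa = x∈p∪q⁺ (inj₁ x∈Aa)
          ... | no  x∉Aa = x∈p∪q⁺ (inj₂ (picked⊆Y (x∈p∧x∉q⇒x∈p─q x∈A x∉Aa)))

          Y#Y'─Y : Disjoint Y (Y' ─ Y)
          Y#Y'─Y x∈Y x∈Y'─Y = x∈p─q⇒x∉q x∈Y'─Y x∈Y

          excess-union : excess D (Y ∪ Y') ≡ excess D (Y' ─ Y)
          excess-union = begin
            excess D (Y ∪ Y')                  ≡⟨ cong (excess D) (∪≡∪-─ Y Y') ⟩
            excess D (Y ∪ (Y' ─ Y))            ≡⟨ excess-∪ D Y#Y'─Y ⟩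
            excess D Y + excess D (Y' ─ Y)     ≡⟨ cong (_+ excess D (Y' ─ Y)) excess≡0 ⟩
            0ℚ + excess D (Y' ─ Y)             ≡⟨ +-identityˡ _ ⟩
            excess D (Y' ─ Y)                  ∎
            where open ≡-Reasoning

          excess-new≤0 : excess D (Y' ─ Y) ≤ 0ℚ
          excess-new≤0 = subst (_≤ 0ℚ) excess-union (excess-nonPos (Rooted-∪ rooted M'.rooted (A-mono a≤t) A⊆A∪Y))

          excess'-new≥0 : 0ℚ ≤ excess D' (Y' ─ Y)
          excess'-new≥0 = +≡0∧≤0⇒0≤ (trans (sym (excess-split D' Y' Y)) M'.excess≡0)
                                     (M'.excess-nonPos (Rooted-∩ M'.rooted rooted (A-mono a≤t)))

        nested : 1 ℕ.≤ s → Σ (t ℕ.< L) λ t<L → chosen t t<L ⊆ Y × D < density t t<L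
        nested 1≤s = still-running 1≤s , chosen⊆Y 1≤s , density-increases 1≤s

      next-edge : ∀ s → s ℕ.< size → Invariant s → Σ (a ℕ.+ s ℕ.< L) λ t<L → edge (a ℕ.+ s) t<L ∈ Y
      next-edge ℕ.zero    _      _   rewrite ℕ.+-identityʳ a = a<L , edge∈chosen a a<L
      next-edge (suc s) s<size inv = let t<L , Y'⊆Y , _ = nested s<size inv (ℕ.s≤s ℕ.z≤n) in
                                     t<L , Y'⊆Y (edge∈chosen _ t<L)

      invariant-suc : ∀ {s} → s ℕ.< size → Invariant s → Invariant (suc s)
      invariant-suc {s} s<size inv with next-edge s s<size inv
      ... | t<L , e∈Y = record
        { running  = shift (ℕ._≤ L) t<L
        ; picked⊆Y = shift (λ u → between a u ⊆ Y) S'⊆Y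
        ; ∣picked∣ = shift (λ u → ∣ between a u ∣ ≡ suc s)
                       (trans (cong ∣_∣ S'≡) (trans (∣p∪⁅x⁆∣≡1+∣p∣ e∉S) (cong suc ∣picked∣)))
        }
        where
        open Invariant inv
        shift : (P : ℕ → Set) → P (suc (a ℕ.+ s)) → P (a ℕ.+ suc s)
        shift P = subst P (sym (ℕ.+-suc a s))
        S'≡ : between a (suc (a ℕ.+ s)) ≡ between a (a ℕ.+ s) ∪ ⁅ edge (a ℕ.+ s) t<L ⁆
        S'≡ = between-suc t<L (ℕ.m≤m+n a s)
        e∉S : edge (a ℕ.+ s) t<L ∉ between a (a ℕ.+ s)
        e∉S = edge∉A _ t<L ∘ p─q⊆p (A (a ℕ.+ s)) (A a)
        S'⊆Y : between a (suc (a ℕ.+ s)) ⊆ Y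
        S'⊆Y x∈ with x∈p∪q⁻ (between a (a ℕ.+ s)) _ (subst (_ ∈_) S'≡ x∈)
        ... | inj₁ x∈S = picked⊆Y x∈S
        ... | inj₂ x∈e = subst (_∈ Y) (sym (x∈⁅y⁆⇒x≡y _ x∈e)) e∈Y

      invariant : ∀ s → s ℕ.≤ size → Invariant s
      invariant ℕ.zero  _ = record
        { running  = shift (ℕ._≤ L) (ℕ.<⇒≤ a<L)
        ; picked⊆Y = shift (λ u → between a u ⊆ Y) (between-self-empty {a})
        ; ∣picked∣ = shift (λ u → ∣ between a u ∣ ≡ 0)
            (ℕ.n≤0⇒n≡0 (subst (∣ between a a ∣ ℕ.≤_) (∣⊥∣≡0 n) (p⊆q⇒∣p∣≤∣q∣ (between-self-empty {a} {Subset.⊥}))))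
        }
        where
        shift : (P : ℕ → Set) → P a → P (a ℕ.+ 0)
        shift P = subst P (sym (ℕ.+-identityʳ a))
      invariant (suc s) s<size = invariant-suc s<size (invariant s (ℕ.<⇒≤ s<size))

      in-block : ∀ s → s ℕ.< size → Σ (a ℕ.+ s ℕ.< L) λ t<L → edge (a ℕ.+ s) t<L ∈ Y
      in-block s s<size = next-edge s s<size (invariant s (ℕ.<⇒≤ s<size))

      chosen-nested : ∀ s → 1 ℕ.≤ s → s ℕ.< size →
                      Σ (a ℕ.+ s ℕ.< L) λ t<L → chosen (a ℕ.+ s) t<L ⊆ Y × D < density (a ℕ.+ s) t<L
      chosen-nested s 1≤s s<size = nested s<size (invariant s (ℕ.<⇒≤ s<size)) 1≤s

      end≤L : a ℕ.+ size ℕ.≤ L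
      end≤L = Invariant.running (invariant size ℕ.≤-refl)

      between-end : between a (a ℕ.+ size) ≡ Y
      between-end = ⊆-antisym picked⊆Y Y⊆S
        where
        open Invariant (invariant size ℕ.≤-refl)
        Y⊆S : Y ⊆ between a (a ℕ.+ size)
        Y⊆S {x} x∈Y with x ∈? between a (a ℕ.+ size)
        ... | yes x∈S = x∈S
        ... | no  x∉S = contradiction (p⊂q⇒∣p∣<∣q∣ (picked⊆Y , x , x∈Y , x∉S)) (ℕ.<-irrefl ∣picked∣)

      Σ∈-A-end : ∀ (f : Fin n → ℚ) → Σ∈ (A (a ℕ.+ size)) f ≡ Σ∈ (A a) f + Σ∈ Y f
      Σ∈-A-end f = trans (Σ∈-A-between f (ℕ.m≤m+n a size)) (cong (λ E → Σ∈ (A a) f + Σ∈ E f) between-end)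

    module Nesting (a : ℕ) (a<L : a ℕ.< L) where
      open Block a a<L
      open MinMax (minmax a a<L) using (Y⊆below-top)

      -- Holds at the first iteration of every maximal sub-block of the block of a (sub-block);
      -- there the top edge of Y pays for the path down to the sub-block (ℓ-first≤ℓ-par).
      BoundaryBound : ℕ → Set
      BoundaryBound s = 0ℚ ≤ excess D (between a (a ℕ.+ s)) + D * c (edge a a<L)

      boundary-first : BoundaryBound 1
      boundary-first rewrite ℕ.+-comm a 1 = subst (0ℚ ≤_) (sym first-edge) (p≥0 _)
        where
        open ≡-Reasoning
        e = edge a a<L
        first-edge : excess D (between a (suc a)) + D * c e ≡ p (suc e)
        first-edge = begin
          excess D (between a (suc a)) + D * c e
            ≡⟨ cong (_+ D * c e) (excess-between-suc D a<L ℕ.≤-refl) ⟩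
          (excess D (between a a) + (p (suc e) - D * c e)) + D * c e
            ≡⟨ cong (λ x → (x + (p (suc e) - D * c e)) + D * c e) (excess-between-self D a) ⟩
          (0ℚ + (p (suc e) - D * c e)) + D * c e
            ≡⟨ solve 2 (λ x y → (con 0ℚ :+ (x :- y)) :+ y := x) refl (p (suc e)) (D * c e) ⟩
          p (suc e)
            ∎

      boundary-next : ∀ {s} → 1 ℕ.≤ s → s ℕ.< size → BoundaryBound s →
        Σ (a ℕ.+ s ℕ.< L) λ b<L →
          s ℕ.+ Block.size (a ℕ.+ s) b<L ℕ.≤ size × BoundaryBound (s ℕ.+ Block.size (a ℕ.+ s) b<L)
      boundary-next {s} 1≤s s<size bound = b<L , end≤size , bound'
        where
        b = a ℕ.+ s
        nested-at-b = chosen-nested s 1≤s s<size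
        b<L = proj₁ nested-at-b
        module B = Block b b<L

        end≤size : s ℕ.+ B.size ℕ.≤ size
        end≤size = ℕ.≮⇒≥ overrun
          where
          overrun : ¬ (size ℕ.< s ℕ.+ B.size)
          overrun size<end = edge∉A (b ℕ.+ r) u<L (subst (λ u → edge (b ℕ.+ r) u<L ∈ A u) (sym b+r≡end) e∈A)
            where
            r = size ℕ.∸ s
            s+r≡size = ℕ.m+[n∸m]≡n (ℕ.<⇒≤ s<size)
            r<bsize = ℕ.+-cancelˡ-< s r B.size (subst (ℕ._< s ℕ.+ B.size) (sym s+r≡size) size<end)
            u<L = proj₁ (B.in-block r r<bsize)
            b+r≡end : b ℕ.+ r ≡ a ℕ.+ size
            b+r≡end = trans (ℕ.+-assoc a s r) (cong (a ℕ.+_) s+r≡size)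
            e∈A : edge (b ℕ.+ r) u<L ∈ A (a ℕ.+ size)
            e∈A = p─q⊆p (A (a ℕ.+ size)) (A a)
                    (subst (edge (b ℕ.+ r) u<L ∈_) (sym between-end) (proj₁ (proj₂ nested-at-b) (proj₂ (B.in-block r r<bsize))))

        excess-Yb-nonNeg : 0ℚ ≤ excess D B.Y
        excess-Yb-nonNeg = subst (_≤ excess D B.Y) (MinMax.excess≡0 (minmax b b<L))
                                 (excess-antitone B.Y (<⇒≤ (proj₂ (proj₂ nested-at-b))))

        excess-end : excess D (between a (a ℕ.+ (s ℕ.+ B.size))) ≡ excess D (between a b) + excess D B.Y
        excess-end = begin
          excess D (between a (a ℕ.+ (s ℕ.+ B.size)))
            ≡⟨ cong (excess D ∘ between a) (sym (ℕ.+-assoc a s B.size)) ⟩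
          excess D (between a (b ℕ.+ B.size))
            ≡⟨ excess-between D (ℕ.m≤m+n a s) (ℕ.m≤m+n b B.size) ⟩
          excess D (between a b) + excess D (between b (b ℕ.+ B.size))
            ≡⟨ cong (λ E → excess D (between a b) + excess D E) B.between-end ⟩
          excess D (between a b) + excess D B.Y
            ∎
          where open ≡-Reasoning

        bound' : BoundaryBound (s ℕ.+ B.size)
        bound' = ≤-trans bound (≤-by-nonNeg-gap _ excess-Yb-nonNeg (trans (cong (_+ D * c (edge a a<L)) excess-end)
          (solve 3 (λ x y z → (x :+ y) :+ z := (x :+ z) :+ y) refl (excess D (between a b)) (excess D B.Y) (D * c (edge a a<L)))))

      record SubBlock (s : ℕ) : Set where
        field
          start    : ℕ
          1≤start  : 1 ℕ.≤ start
          start≤s  : start ℕ.≤ s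
          start<L  : a ℕ.+ start ℕ.< L
          bound    : BoundaryBound start
          s<end    : s ℕ.< start ℕ.+ Block.size (a ℕ.+ start) start<L

      private
        s<s+size : ∀ s (s<size : s ℕ.< size) → s ℕ.< s ℕ.+ Block.size (a ℕ.+ s) (proj₁ (in-block s s<size))
        s<s+size s s<size = ℕ.m<m+n s (x∈p⇒0<∣p∣ (edge∈chosen (a ℕ.+ s) (proj₁ (in-block s s<size))))

      sub-block : ∀ s → 1 ℕ.≤ s → s ℕ.< size → SubBlock s
      sub-block (suc ℕ.zero) _ 1<size = record
        { start = 1 ; 1≤start = ℕ.≤-refl ; start≤s = ℕ.≤-refl ; start<L = proj₁ (in-block 1 1<size)
        ; bound = boundary-first ; s<end = s<s+size 1 1<size }
      sub-block (suc (suc r)) _ s<size with sub-block (suc r) (ℕ.s≤s ℕ.z≤n) (ℕ.<-trans (ℕ.n<1+n (suc r)) s<size)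
      ... | previous with suc (suc r) ℕ.<? SubBlock.start previous ℕ.+ Block.size _ (SubBlock.start<L previous)
      ...   | yes s<new-end = record
        { start = start ; 1≤start = 1≤start ; start≤s = ℕ.m≤n⇒m≤1+n start≤s ; start<L = start<L
        ; bound = bound ; s<end = s<new-end }
        where open SubBlock previous
      ...   | no  s≮end = record
        { start = suc (suc r) ; 1≤start = ℕ.s≤s ℕ.z≤n ; start≤s = ℕ.≤-refl ; start<L = proj₁ (in-block _ s<size)
        ; bound = subst BoundaryBound end≡s (proj₂ (proj₂ next)) ; s<end = s<s+size _ s<size }
        where
        open SubBlock previous
        next = boundary-next 1≤start (ℕ.≤-<-trans start≤s (ℕ.<-trans (ℕ.n<1+n (suc r)) s<size)) bound
        end≡s : start ℕ.+ Block.size (a ℕ.+ start) (proj₁ next) ≡ suc (suc r)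
        end≡s = ℕ.≤-antisym (ℕ.≮⇒≥ s≮end) s<end

      ℓ-first≤ℓ-par : ∀ {s} → 1 ℕ.≤ s → (s<size : s ℕ.< size) →
                      ℓ G (par (edge a a<L)) + c (edge a a<L) ≤ ℓ G (par (edge (a ℕ.+ s) (proj₁ (in-block s s<size))))
      ℓ-first≤ℓ-par {s} 1≤s s<size with in-block s s<size
      ... | t<L , e∈Y
        with ≼-suc⁻ (∈-subsetOf⁻ _ (Y⊆below-top (A-closed a (ℕ.<⇒≤ a<L)) (edge∈chosen a a<L) (par-edge a a<L) e∈Y))
      ...   | inj₁ first≡e = contradiction (subst (_∈ A (a ℕ.+ s)) (suc-injective first≡e) first∈A) (edge∉A _ t<L)
        where
        first∈A = p─q⊆p (A (a ℕ.+ s)) (A a) (edge-a∈between (ℕ.m<m+n a 1≤s))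
      ...   | inj₂ first≼par = subst (_≤ ℓ G (par (edge (a ℕ.+ s) t<L)))
        (trans (ℓ-suc (edge a a<L)) (+-comm (c (edge a a<L)) _)) (≼⇒ℓ≤ℓ first≼par)

    -- Lower bounds on the prize of Alg

    PathBound : ℕ → Set
    PathBound s = ∀ a (a<L : a ℕ.< L) t → a ℕ.+ s ≡ t → s ℕ.< Block.size a a<L → .(t<L : t ℕ.< L) →
      0ℚ ≤ excess (density a a<L) (between a t) + density a a<L * (ℓ G (par (edge t t<L)) - ℓ G (par (edge a a<L)))

    path-bound : ∀ s → PathBound s
    path-bound = <-rec PathBound bound
      where
      bound : ∀ s → (∀ {r} → r ℕ.< s → PathBound r) → PathBound s
      bound ℕ.zero _ a a<L t a+0≡t _ t<L = subst BoundAt (trans (sym (ℕ.+-identityʳ a)) a+0≡t) at-start t<L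
        where
        D = density a a<L
        ℓa = ℓ G (par (edge a a<L))
        BoundAt : ℕ → Set
        BoundAt u = ∀ .(u<L : u ℕ.< L) → 0ℚ ≤ excess D (between a u) + D * (ℓ G (par (edge u u<L)) - ℓa)
        at-start : BoundAt a
        at-start _ = ≤-reflexive (sym (trans (cong (_+ D * (ℓa - ℓa)) (excess-between-self D a))
          (solve 2 (λ D x → con 0ℚ :+ D :* (x :- x) := con 0ℚ) refl D ℓa)))
      bound s@(suc _) earlier a a<L t a+s≡t s<size t<L =
        subst (λ x → 0ℚ ≤ x + D * (ℓt - ℓa)) (sym (excess-between D (ℕ.m≤m+n a start) b≤t)) combined
        where
        open Nesting a a<L using (sub-block; module SubBlock; ℓ-first≤ℓ-par)
        open SubBlock (sub-block s (ℕ.s≤s ℕ.z≤n) s<size) renaming (bound to bound-start)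
        D = density a a<L
        b = a ℕ.+ start
        ℓa = ℓ G (par (edge a a<L))
        ℓb = ℓ G (par (edge b start<L))
        ℓt = ℓ G (par (edge t t<L))
        start<size = ℕ.≤-<-trans start≤s s<size
        r = s ℕ.∸ start
        start+r≡s = ℕ.m+[n∸m]≡n start≤s
        b+r≡t : b ℕ.+ r ≡ t
        b+r≡t = trans (ℕ.+-assoc a start r) (trans (cong (a ℕ.+_) start+r≡s) a+s≡t)
        b≤t : b ℕ.≤ t
        b≤t = subst (b ℕ.≤_) b+r≡t (ℕ.m≤m+n b r)
        r<bsize : r ℕ.< Block.size b start<L
        r<bsize = ℕ.+-cancelˡ-< start r (Block.size b start<L) (subst (ℕ._< start ℕ.+ Block.size b start<L) (sym start+r≡s) s<end)
        shifted : 0ℚ ≤ excess D (between b t) + D * (ℓt - ℓb)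
        shifted = excess-shift (between b t) (ℓt - ℓb) (dens-nonNeg (Block.Y a a<L))
          (<⇒≤ (proj₂ (proj₂ (Block.chosen-nested a a<L start 1≤start start<size))))
          (earlier (ℕ.∸-monoʳ-< 1≤start start≤s) b start<L t b+r≡t r<bsize t<L)
        combined : 0ℚ ≤ (excess D (between a b) + excess D (between b t)) + D * (ℓt - ℓa)
        combined = combine-bounds (excess D (between a b)) (excess D (between b t)) {ℓa = ℓa} {ℓb} {ℓt}
          bound-start shifted (dens-nonNeg (Block.Y a a<L)) (ℓ-first≤ℓ-par 1≤start start<size)

    χ-nonNeg : 0ℚ ≤ χ G
    χ-nonNeg = ≤-trans (ℓ-nonNeg zero) (ℓ≤χ zero)

    module _ (a : ℕ) (a<L : a ℕ.< L) {B : ℚ} where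
      open Block a a<L

      whole-block-bound : B ≤ costE G (A a) + costE G Y → prizeE G (A a) + D * (B - costE G (A a)) ≤ prizeE G (A (a ℕ.+ size))
      whole-block-bound B≤Ca+CY = ≤-by-nonNeg-gap _ (0≤-* (dens-nonNeg Y) (≤⇒0≤- B≤Ca+CY))
        (trans (Σ∈-A-end (p ∘ suc)) (trans (cong (prizeE G (A a) +_) (prizeE≡dens*costE Y))
          (solve 5 (λ P D B Ca CY → P :+ D :* CY := (P :+ D :* (B :- Ca)) :+ D :* ((Ca :+ CY) :- B)) refl
                   (prizeE G (A a)) D B (costE G (A a)) (costE G Y))))

      partial-block-bound : ∀ s (s<size : s ℕ.< size) → B + χ G < costE G (A (a ℕ.+ suc s)) →
                            prizeE G (A a) + D * (B - costE G (A a)) ≤ prizeE G (A (a ℕ.+ s))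
      partial-block-bound s s<size overshoot = subst (prizeE G (A a) + D * (B - costE G (A a)) ≤_)
        (sym (Σ∈-A-between (p ∘ suc) (ℕ.m≤m+n a s)))
        (+-monoʳ-≤ (prizeE G (A a)) (≤-trans (*-monoˡ-≤-nonNeg D {{nonNegative (dens-nonNeg Y)}} budget≤) path))
        where
        t = a ℕ.+ s
        t<L = proj₁ (in-block s s<size)
        S = between a t
        e = edge t t<L
        ℓt = ℓ G (par e)
        overshoot' : B + χ G < (costE G (A a) + costE G S) + c e
        overshoot' = subst (B + χ G <_) (trans (cong (λ u → costE G (A u)) (ℕ.+-suc a s))
                       (trans (Σ∈-A-suc t t<L c) (cong (_+ c e) (Σ∈-A-between c (ℕ.m≤m+n a s))))) overshoot
        ℓ[e]≤χ : ℓt + c e ≤ χ G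
        ℓ[e]≤χ = subst (_≤ χ G) (trans (ℓ-suc e) (+-comm (c e) ℓt)) (ℓ≤χ (suc e))
        budget≤ : B - costE G (A a) ≤ costE G S - ℓt
        budget≤ = 0≤-⇒≤ (subst (0ℚ ≤_) slack (0≤-+ (<⇒≤ (<⇒0<- overshoot')) (≤⇒0≤- ℓ[e]≤χ)))
          where
          slack : ((costE G (A a) + costE G S) + c e - (B + χ G)) + (χ G - (ℓt + c e)) ≡ (costE G S - ℓt) - (B - costE G (A a))
          slack = solve 6 (λ Ca CS ce B χ ℓt → ((Ca :+ CS) :+ ce :- (B :+ χ)) :+ (χ :- (ℓt :+ ce))
                                            := (CS :- ℓt) :- (B :- Ca)) refl
                          (costE G (A a)) (costE G S) (c e) B (χ G) ℓt
        path : D * (costE G S - ℓt) ≤ prizeE G S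
        path = ≤-by-nonNeg-gap (prizeE G S) (0≤-+ (path-bound s a a<L t refl s<size t<L) (0≤-* (dens-nonNeg Y) (ℓ-nonNeg _)))
          (solve 5 (λ P C D ℓt ℓa → P := D :* (C :- ℓt) :+ (((P :- D :* C) :+ D :* (ℓt :- ℓa)) :+ D :* ℓa)) refl
                   (prizeE G S) (costE G S) D ℓt (ℓ G (par (edge a a<L))))

    block-bound : ∀ a (a<L : a ℕ.< L) B → costE G (A a) ≤ B → B ≤ costE G (A a) + costE G (Block.Y a a<L) →
                  prizeE G (A a) + density a a<L * (B - costE G (A a)) ≤ pAlg G X (B + χ G)
    block-bound a a<L B Ca≤B B≤Ca+CY with costE G (A (a ℕ.+ Block.size a a<L)) ≤? B + χ G
    ... | yes whole-fits = ≤-trans (whole-block-bound a a<L {B} B≤Ca+CY)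
                                   (prizeE-A≤pAlg _ (Block.end≤L a a<L) (B + χ G) whole-fits)
    ... | no  whole-exceeds with crossing (λ s → costE G (A (a ℕ.+ s)) ≤? B + χ G) start-fits (Block.size a a<L) whole-exceeds
      where
      start-fits : costE G (A (a ℕ.+ 0)) ≤ B + χ G
      start-fits = subst (λ u → costE G (A u) ≤ B + χ G) (sym (ℕ.+-identityʳ a))
        (≤-trans Ca≤B (≤-by-nonNeg-gap (B + χ G) χ-nonNeg refl))
    ... | s , s<size , fits , exceeds = ≤-trans (partial-block-bound a a<L {B} s s<size (≰⇒> exceeds))
                                                (prizeE-A≤pAlg _ (ℕ.<⇒≤ (proj₁ (Block.in-block a a<L s s<size))) (B + χ G) fits)

    record TreeStart (Ts' : List (Subset n)) (s : ℕ) (j : Fin (length Ts')) : Set where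
      field
        iteration    : ℕ
        iteration<L  : iteration ℕ.< L
        tree≡chosen  : lookup Ts' j ≡ chosen iteration iteration<L
        sum-before   : ∀ w → sumℚ (take (toℕ j) (map (λ T → Σ∈ T w) Ts')) + Σ∈ (A s) w ≡ Σ∈ (A iteration) w

    tree-start : ∀ f s → s ℕ.≤ L → (j : Fin (length (map chosenAt (starts G X f s)))) →
                 TreeStart (map chosenAt (starts G X f s)) s j
    tree-start (suc f) s s≤L j with s ℕ.<? L
    tree-start (suc f) s s≤L zero    | yes s<L = record
      { iteration = s ; iteration<L = s<L ; tree≡chosen = refl ; sum-before = λ w → +-identityˡ (Σ∈ (A s) w) }
    tree-start (suc f) s s≤L (suc j) | yes s<L = record
      { iteration = iteration ; iteration<L = iteration<L ; tree≡chosen = tree≡chosen ; sum-before = sum-before' }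
      where
      open Block s s<L using (Y; size; end≤L; Σ∈-A-end)
      open TreeStart (tree-start f (s ℕ.+ size) end≤L j)
      rest = map chosenAt (starts G X f (s ℕ.+ size))
      sum-before' : ∀ w → (Σ∈ Y w + sumℚ (take (toℕ j) (map (λ T → Σ∈ T w) rest))) + Σ∈ (A s) w
                          ≡ Σ∈ (A iteration) w
      sum-before' w = trans (solve 3 (λ y r a → (y :+ r) :+ a := r :+ (a :+ y)) refl (Σ∈ Y w) Σ-rest (Σ∈ (A s) w))
                            (trans (cong (Σ-rest +_) (sym (Σ∈-A-end w))) (sum-before w))
        where Σ-rest = sumℚ (take (toℕ j) (map (λ T → Σ∈ T w) rest))

corollary11 : ∀ {n} (G : Tree n) → Tree.p G zero ≡ 0ℚ →
    (X : Execution G) → (B : ℚ) → 0ℚ ≤ B →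
    (j : Fin (k G X)) →
    sumℚ (take (toℕ j) (map (costE G) (Ts G X))) ≤ B →
    B ≤ sumℚ (take (suc (toℕ j)) (map (costE G) (Ts G X))) →
    sumℚ (take (toℕ j) (map (λ T → dens G T * costE G T) (Ts G X)))
      + dens G (lookup (Ts G X) j) * (B - sumℚ (take (toℕ j) (map (costE G) (Ts G X))))
      ≤ pAlg G X (B + χ G)
corollary11 G _ X B _ j before≤B B≤after =
  subst (_≤ pAlg G X (B + χ G)) block≡goal
    (block-bound iteration iteration<L B (subst (_≤ B) costs-before≡ before≤B) (subst (B ≤_) costs-through≡ B≤after))
  where
  open Tree G using (p; c)
  open Greedy G
  open Run X
  open TreeStart (tree-start L 0 ℕ.z≤n j)

  costs-before = take (toℕ j) (map (costE G) (Ts G X))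

  from-A0 : ∀ w x → x + Σ∈ (A 0) w ≡ x
  from-A0 w x = trans (cong (x +_) (Σ∈-⊥ w)) (+-identityʳ x)

  costs-before≡ : sumℚ costs-before ≡ costE G (A iteration)
  costs-before≡ = trans (sym (from-A0 c _)) (sum-before c)

  prizes-before≡ : sumℚ (take (toℕ j) (map (λ T → dens G T * costE G T) (Ts G X))) ≡ prizeE G (A iteration)
  prizes-before≡ = trans (cong (sumℚ ∘ take (toℕ j)) (map-cong (sym ∘ prizeE≡dens*costE) (Ts G X)))
                         (trans (sym (from-A0 (p ∘ suc) _)) (sum-before (p ∘ suc)))

  block≡goal : prizeE G (A iteration) + density iteration iteration<L * (B - costE G (A iteration))
             ≡ sumℚ (take (toℕ j) (map (λ T → dens G T * costE G T) (Ts G X)))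
               + dens G (lookup (Ts G X) j) * (B - sumℚ costs-before)
  block≡goal = sym (cong₂ _+_ prizes-before≡ (cong₂ (λ T C → dens G T * (B - C)) tree≡chosen costs-before≡))

  costs-through≡ : sumℚ (take (suc (toℕ j)) (map (costE G) (Ts G X)))
                   ≡ costE G (A iteration) + costE G (chosen iteration iteration<L)
  costs-through≡ = trans (sumℚ-take-suc (Ts G X) (costE G) j) (cong₂ _+_ costs-before≡ (cong (costE G) tree≡chosen))
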